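{- Let $p$ be a prime, $n\ge0$ an integer, \[R=\begin{pmatrix}\mathbb Z_p&p^n\mathbb Z_p&\mathbb Z_p&\mathbb Z_p\\ \mathbb Z_p&\mathbb Z_p&\mathbb Z_p&p^{ -n}\mathbb Z_p\\ \mathbb Z_p&p^n\mathbb Z_p&\mathbb Z_p&\mathbb Z_p\\ p^n\mathbb Z_p&p^n\mathbb Z_p&p^n\mathbb Z_p&\mathbb Z_p\end{pmatrix}\subset M_4(\mathbb Q_p),\qquad W_{p^n}=\begin{pmatrix}0&p^n&0&0\\1&0&0&0\\0&0&0&1\\0&0&p^n&0\end{pmatrix}.\] Then the normaliser $\{g\in \mathrm{GL}_4(\mathbb Q_p): g^{ -1}Rg=R\}$ of $R$ equals $\bigcup_{\mu\in\{0,1\}} p^{\mathbb Z}\,W_{p^n}^{\mu}\,R^\times$. -}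

module Defs where

open import Data.Nat as ℕ using (ℕ; zero; suc)
open import Data.Integer as ℤ using (ℤ; +_; -[1+_]; _+_; _*_; _-_; -_)
open import Data.Integer.Divisibility.Signed using (_∣_; divides; ∣m∣n⇒∣m+n; ∣n⇒∣m*n; ∣m⇒∣m*n)
open import Data.Integer.Tactic.RingSolver using (solve-∀)
open import Data.Fin as Fin using (Fin; zero; suc)
open import Relation.Nullary.Decidable using (⌊_⌋)
open import Data.Bool using (Bool; true; false; if_then_else_)
open import Data.Product using (Σ; ∃; _×_; _,_)
open import Relation.Binary.PropositionalEquality using (_≡_; refl; subst; sym)

-- Everything is parameterised by the (prime) p.
-- ℤ_p is the inverse limit of ℤ/p^kℤ: a p-adic integer is a sequence of
-- integers (a_k) with a_{k+1} ≡ a_k (mod p^k); two such are equal iff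
-- a_k ≡ b_k (mod p^k) for all k.
-- ℚ_p = ℤ_p[1/p]: an element is a pair (d, a) denoting p^{-d} · a.

module _ (p : ℕ) where

  infix 4 _≈ℤp_ _≈_ _≈M_
  infixl 6 _+ℤp_ _+Q_
  infixl 7 _*ℤp_ _*Q_ _·_

  P^ : ℕ → ℤ
  P^ k = + (p ℕ.^ k)

  Coherent : (ℕ → ℤ) → Set
  Coherent f = ∀ k → P^ k ∣ (f (suc k) - f k)

  record ℤp : Set where
    constructor mkℤp
    field
      seq : ℕ → ℤ
      coh : Coherent seq
  open ℤp public

  _≈ℤp_ : ℤp → ℤp → Set
  a ≈ℤp b = ∀ k → P^ k ∣ (seq a k - seq b k)

  private
    lem+ : ∀ a b c d → (a + b) - (c + d) ≡ (a - c) + (b - d)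
    lem+ = solve-∀
    lem* : ∀ a b c d → (a * b) - (c * d) ≡ a * (b - d) + (a - c) * d
    lem* = solve-∀
    lem0 : ∀ c → c - c ≡ (+ 0) * c
    lem0 = solve-∀

  constℤp : ℤ → ℤp
  constℤp c = mkℤp (λ _ → c) (λ k → divides (+ 0) (subst (λ z → c - c ≡ z) refl (trans0 k)))
    where
    trans0 : ∀ k → c - c ≡ + 0 * P^ k
    trans0 k rewrite lem0 c = refl

  _+ℤp_ : ℤp → ℤp → ℤp
  mkℤp f fc +ℤp mkℤp g gc = mkℤp (λ k → f k + g k)
    (λ k → subst (P^ k ∣_) (sym (lem+ (f (suc k)) (g (suc k)) (f k) (g k)))
                 (∣m∣n⇒∣m+n (fc k) (gc k)))

  _*ℤp_ : ℤp → ℤp → ℤp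
  mkℤp f fc *ℤp mkℤp g gc = mkℤp (λ k → f k * g k)
    (λ k → subst (P^ k ∣_) (sym (lem* (f (suc k)) (g (suc k)) (f k) (g k)))
                 (∣m∣n⇒∣m+n (∣n⇒∣m*n (f (suc k)) (gc k)) (∣m⇒∣m*n (g k) (fc k))))

  record ℚp : Set where
    constructor _/p^_
    field
      num : ℤp
      den : ℕ
  open ℚp public

  -- p^{-d} a = p^{-e} b  iff  p^e a = p^d b in ℤ_p
  _≈_ : ℚp → ℚp → Set
  x ≈ y = (constℤp (P^ (den y)) *ℤp num x) ≈ℤp (constℤp (P^ (den x)) *ℤp num y)

  _+Q_ : ℚp → ℚp → ℚp
  x +Q y = ((constℤp (P^ (den y)) *ℤp num x) +ℤp (constℤp (P^ (den x)) *ℤp num y))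
             /p^ (den x ℕ.+ den y)

  _*Q_ : ℚp → ℚp → ℚp
  x *Q y = (num x *ℤp num y) /p^ (den x ℕ.+ den y)

  ι : ℤp → ℚp
  ι a = a /p^ 0

  0Q 1Q : ℚp
  0Q = ι (constℤp (+ 0))
  1Q = ι (constℤp (+ 1))

  pow : ℤ → ℚp
  pow (+ k)     = ι (constℤp (P^ k))
  pow -[1+ j ]  = constℤp (+ 1) /p^ (suc j)

  _∈p^_ℤp : ℚp → ℤ → Set
  x ∈p^ e ℤp = ∃ λ (a : ℤp) → x ≈ (pow e *Q ι a)

  Mat : Set
  Mat = Fin 4 → Fin 4 → ℚp

  _≈M_ : Mat → Mat → Set
  A ≈M B = ∀ i j → A i j ≈ B i j

  _·_ : Mat → Mat → Mat
  (A · B) i j = (((A i zero *Q B zero j)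
              +Q (A i (suc zero) *Q B (suc zero) j))
              +Q (A i (suc (suc zero)) *Q B (suc (suc zero)) j))
              +Q (A i (suc (suc (suc zero))) *Q B (suc (suc (suc zero))) j)

  I : Mat
  I i j = if ⌊ i Fin.≟ j ⌋ then 1Q else 0Q

  scale : ℚp → Mat → Mat
  scale c A i j = c *Q A i j

  IsGL : Mat → Set
  IsGL g = ∃ λ h → (g · h ≈M I) × (h · g ≈M I)

  module _ (n : ℕ) where

    -- exponent e(i,j) with R_{ij} = p^{e(i,j)} ℤ_p
    Rexp : Fin 4 → Fin 4 → ℤ
    Rexp zero (suc zero) = + n
    Rexp (suc zero) (suc (suc (suc zero))) = - (+ n)
    Rexp (suc (suc zero)) (suc zero) = + n
    Rexp (suc (suc (suc zero))) zero = + n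
    Rexp (suc (suc (suc zero))) (suc zero) = + n
    Rexp (suc (suc (suc zero))) (suc (suc zero)) = + n
    Rexp _ _ = + 0

    InR : Mat → Set
    InR x = ∀ i j → x i j ∈p^ Rexp i j ℤp

    IsUnitR : Mat → Set
    IsUnitR r = InR r × (∃ λ r' → InR r' × (r · r' ≈M I) × (r' · r ≈M I))

    W : Mat
    W zero (suc zero) = pow (+ n)
    W (suc zero) zero = 1Q
    W (suc (suc zero)) (suc (suc (suc zero))) = 1Q
    W (suc (suc (suc zero))) (suc (suc zero)) = pow (+ n)
    W _ _ = 0Q

    W^ : Bool → Mat
    W^ false = I
    W^ true  = W

    -- g⁻¹ R g = R, where h is the inverse of g (as an equality of subsets
    -- of M₄(ℚ_p): both inclusions)
    Normalises : (g h : Mat) → Set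
    Normalises g h =
      (∀ x → InR x → InR (h · (x · g))) ×
      (∀ y → InR y → ∃ λ x → InR x × (y ≈M (h · (x · g))))

    InUnion : Mat → Set
    InUnion g = ∃ λ (k : ℤ) → ∃ λ (μ : Bool) → ∃ λ r →
      IsUnitR r × (g ≈M scale (pow k) (W^ μ · r))

{-# OPTIONS --safe #-}

-- If g normalises R, conjugating the matrix
-- units of R shows that every product h_{ai} g_{jb} and g_{ai} h_{jb} has valuation at least
-- e(a,b) − e(i,j), where h = g⁻¹ and e is the exponent matrix of R.  Since (g h)_{aa} = 1 there is,
-- for each row a, a column I with v(g_{aI}) + v(h_{Ia}) ≤ 0.  Choosing such pivots in rows 0 and 1
-- and comparing their columns modulo 2, these valuation bounds either contradict n ≥ 1 or pin every
-- entry down: v(g_{jb}) ≥ k + e(j,b) and v(h_{jb}) ≥ −k + e(j,b) for k = v(g_{0I}), i.e.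
-- p^{−k} g ∈ R^×; when the pivots sit in an odd and an even column one first replaces g by W⁻¹ g.
-- Conversely R^×, W and the scalars p^k all normalise R.

module Submission where

open import Algebra.Bundles using (CommutativeRing; Monoid)
open import Data.Bool using (Bool; true; false; if_then_else_; _∧_)
open import Data.Empty using (⊥; ⊥-elim)
open import Data.Fin as Fin using (Fin)
open import Data.Fin.Patterns using (0F; 1F; 2F; 3F)
open import Data.Fin.Properties using (all?)
open import Data.Integer as ℤ using (ℤ; +_; -[1+_]; 1ℤ; -1ℤ; _-_; -_; _≤?_)
import Data.Integer.Properties as ℤ
open import Data.Integer.Divisibility.Signed
open import Data.Integer.Tactic.RingSolver using (solve-∀)
open import Data.Nat as ℕ using (ℕ; zero; suc)
import Data.Nat.Properties as ℕ
import Data.Nat.Divisibility as ℕ∣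
open ℕ∣ using () renaming (_∣_ to _ℕ∣_; _∣?_ to _ℕ∣?_)
open import Data.Nat.Primality using (Prime; euclidsLemma; prime⇒nonZero; prime⇒nonTrivial)
open import Data.Nat.Tactic.RingSolver using () renaming (solve-∀ to ℕ-solve-∀)
open import Data.Product using (∃; _×_; _,_; proj₁; proj₂; uncurry)
open import Data.Sum using (_⊎_; inj₁; inj₂; [_,_]′)
open import Function.Bundles using (_⇔_; mk⇔; Equivalence)
open import Level using (_⊔_; 0ℓ) renaming (suc to lsuc)
open import Relation.Binary.Bundles using (Setoid)
open import Relation.Binary.PropositionalEquality as ≡ using (_≡_; _≢_)
import Relation.Binary.Reasoning.Setoid
open import Relation.Nullary using (¬_; Dec; yes; no)
open import Relation.Nullary.Decidable using (⌊_⌋; toWitness; _⊎-dec_; map′)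
import Defs

-- 4 × 4 matrices over a commutative ring

module Matrix4 {c ℓ} (R : CommutativeRing c ℓ) where

  open CommutativeRing R
  open import Algebra.Properties.CommutativeSemigroup *-commutativeSemigroup using (x∙yz≈y∙xz)
  private module ≈-Reasoning = Relation.Binary.Reasoning.Setoid setoid

  Mat : Set c
  Mat = Fin 4 → Fin 4 → Carrier

  -- Σ is opaque so that the matrix arguments of lemmas about _∙_ can be inferred.
  opaque
    Σ : (Fin 4 → Carrier) → Carrier
    Σ f = ((f 0F + f 1F) + f 2F) + f 3F

    Σ-expand : ∀ f → Σ f ≡ ((f 0F + f 1F) + f 2F) + f 3F
    Σ-expand f = ≡.refl

    Σ-cong-≡ : ∀ {f g} → (∀ k → f k ≡ g k) → Σ f ≡ Σ g
    Σ-cong-≡ f≡g = ≡.cong₂ _+_ (≡.cong₂ _+_ (≡.cong₂ _+_ (f≡g 0F) (f≡g 1F)) (f≡g 2F)) (f≡g 3F)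

    Σ-cong : ∀ {f g} → (∀ k → f k ≈ g k) → Σ f ≈ Σ g
    Σ-cong f≈g = +-cong (+-cong (+-cong (f≈g 0F) (f≈g 1F)) (f≈g 2F)) (f≈g 3F)

    Σ-distribˡ : ∀ x f → x * Σ f ≈ Σ λ k → x * f k
    Σ-distribˡ x f = trans (distribˡ x _ _) (+-congʳ (trans (distribˡ x _ _) (+-congʳ (distribˡ x _ _))))

    Σ-distribʳ : ∀ x f → Σ f * x ≈ Σ λ k → f k * x
    Σ-distribʳ x f = trans (distribʳ x _ _) (+-congʳ (trans (distribʳ x _ _) (+-congʳ (distribʳ x _ _))))

    Σ-+ : ∀ f g → (Σ λ k → f k + g k) ≈ Σ f + Σ g
    Σ-+ f g = trans (+-congʳ (trans (+-congʳ (interchange _ _ _ _)) (interchange _ _ _ _))) (interchange _ _ _ _)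
      where open import Algebra.Properties.CommutativeSemigroup +-commutativeSemigroup using (interchange)

    Σ-comm : ∀ (f : Fin 4 → Fin 4 → Carrier) → (Σ λ k → Σ λ l → f k l) ≈ (Σ λ l → Σ λ k → f k l)
    Σ-comm f = sym (trans (Σ-+ (λ l → f 0F l + f 1F l + f 2F l) (f 3F))
                    (+-congʳ (trans (Σ-+ (λ l → f 0F l + f 1F l) (f 2F)) (+-congʳ (Σ-+ (f 0F) (f 1F))))))

    Σ-support : ∀ i f → (∀ k → k ≢ i → f k ≈ 0#) → Σ f ≈ f i
    Σ-support 0F f f≈0 = begin
      ((f 0F + f 1F) + f 2F) + f 3F ≈⟨ +-cong (+-cong (+-congˡ (f≈0 1F λ ())) (f≈0 2F λ ())) (f≈0 3F λ ()) ⟩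
      ((f 0F + 0#) + 0#) + 0#       ≈⟨ trans (+-identityʳ _) (trans (+-identityʳ _) (+-identityʳ _)) ⟩
      f 0F                          ∎
      where open ≈-Reasoning
    Σ-support 1F f f≈0 = begin
      ((f 0F + f 1F) + f 2F) + f 3F ≈⟨ +-cong (+-cong (+-congʳ (f≈0 0F λ ())) (f≈0 2F λ ())) (f≈0 3F λ ()) ⟩
      ((0# + f 1F) + 0#) + 0#       ≈⟨ trans (+-identityʳ _) (trans (+-identityʳ _) (+-identityˡ _)) ⟩
      f 1F                          ∎
      where open ≈-Reasoning
    Σ-support 2F f f≈0 = begin
      ((f 0F + f 1F) + f 2F) + f 3F ≈⟨ +-cong (+-congʳ (+-cong (f≈0 0F λ ()) (f≈0 1F λ ()))) (f≈0 3F λ ()) ⟩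
      ((0# + 0#) + f 2F) + 0#       ≈⟨ trans (+-identityʳ _) (trans (+-congʳ (+-identityʳ _)) (+-identityˡ _)) ⟩
      f 2F                          ∎
      where open ≈-Reasoning
    Σ-support 3F f f≈0 = begin
      ((f 0F + f 1F) + f 2F) + f 3F ≈⟨ +-congʳ (+-cong (+-cong (f≈0 0F λ ()) (f≈0 1F λ ())) (f≈0 2F λ ())) ⟩
      ((0# + 0#) + 0#) + f 3F       ≈⟨ trans (+-congʳ (trans (+-identityʳ _) (+-identityʳ _))) (+-identityˡ _) ⟩
      f 3F                          ∎
      where open ≈-Reasoning

  infixl 7 _∙_
  infix 4 _≈M_

  _∙_ : Mat → Mat → Mat
  (A ∙ B) i j = Σ λ k → A i k * B k j

  I : Mat
  I i j = if ⌊ i Fin.≟ j ⌋ then 1# else 0#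

  scale : Carrier → Mat → Mat
  scale x A i j = x * A i j

  _≈M_ : Mat → Mat → Set ℓ
  A ≈M B = ∀ i j → A i j ≈ B i j

  I-diagonal : ∀ i → I i i ≡ 1#
  I-diagonal i with i Fin.≟ i
  ... | yes _ = ≡.refl
  ... | no i≢i = ⊥-elim (i≢i ≡.refl)

  I-offDiagonal : ∀ {i j} → i ≢ j → I i j ≡ 0#
  I-offDiagonal {i} {j} i≢j with i Fin.≟ j
  ... | yes i≡j = ⊥-elim (i≢j i≡j)
  ... | no _ = ≡.refl

  ∙-identityˡ : ∀ A → I ∙ A ≈M A
  ∙-identityˡ A i j = begin
    (I ∙ A) i j     ≈⟨ Σ-support i (λ k → I i k * A k j) (λ k k≢i →
                         trans (*-congʳ (reflexive (I-offDiagonal (≡.≢-sym k≢i)))) (zeroˡ (A k j))) ⟩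
    I i i * A i j   ≈⟨ trans (*-congʳ (reflexive (I-diagonal i))) (*-identityˡ _) ⟩
    A i j           ∎
    where open ≈-Reasoning

  ∙-identityʳ : ∀ A → A ∙ I ≈M A
  ∙-identityʳ A i j = begin
    (A ∙ I) i j     ≈⟨ Σ-support j (λ k → A i k * I k j) (λ k k≢j →
                         trans (*-congˡ (reflexive (I-offDiagonal k≢j))) (zeroʳ (A i k))) ⟩
    A i j * I j j   ≈⟨ trans (*-congˡ (reflexive (I-diagonal j))) (*-identityʳ _) ⟩
    A i j           ∎
    where open ≈-Reasoning

  ∙-assoc : ∀ A B C → (A ∙ B) ∙ C ≈M A ∙ (B ∙ C)
  ∙-assoc A B C i j = begin
    (Σ λ l → (Σ λ k → A i k * B k l) * C l j)  ≈⟨ Σ-cong (λ l → trans (Σ-distribʳ (C l j) (λ k → A i k * B k l))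
                                                                     (Σ-cong λ k → *-assoc (A i k) (B k l) (C l j))) ⟩
    (Σ λ l → Σ λ k → A i k * (B k l * C l j))  ≈⟨ sym (Σ-comm λ k l → A i k * (B k l * C l j)) ⟩
    (Σ λ k → Σ λ l → A i k * (B k l * C l j))  ≈⟨ Σ-cong (λ k → sym (Σ-distribˡ (A i k) (λ l → B k l * C l j))) ⟩
    (Σ λ k → A i k * (B ∙ C) k j)              ∎
    where open ≈-Reasoning

  ∙-cong : ∀ {A A′ B B′} → A ≈M A′ → B ≈M B′ → A ∙ B ≈M A′ ∙ B′
  ∙-cong A≈A′ B≈B′ i j = Σ-cong λ k → *-cong (A≈A′ i k) (B≈B′ k j)

  scale-cong : ∀ {x y A B} → x ≈ y → A ≈M B → scale x A ≈M scale y B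
  scale-cong x≈y A≈B i j = *-cong x≈y (A≈B i j)

  scale-∙ˡ : ∀ x A B → scale x A ∙ B ≈M scale x (A ∙ B)
  scale-∙ˡ x A B i j = trans (Σ-cong λ k → *-assoc x (A i k) (B k j)) (sym (Σ-distribˡ x λ k → A i k * B k j))

  scale-∙ʳ : ∀ x A B → A ∙ scale x B ≈M scale x (A ∙ B)
  scale-∙ʳ x A B i j = trans (Σ-cong λ k → x∙yz≈y∙xz (A i k) x (B k j)) (sym (Σ-distribˡ x λ k → A i k * B k j))

  scale-scale : ∀ x y A → scale x (scale y A) ≈M scale (x * y) A
  scale-scale x y A i j = sym (*-assoc x y (A i j))

  scale-identity : ∀ A → scale 1# A ≈M A
  scale-identity A i j = *-identityˡ (A i j)

  Monomial : (Fin 4 → Fin 4) → Mat → Set ℓ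
  Monomial σ A = ∀ i k → k ≢ σ i → A i k ≈ 0#

  ∙-monomialˡ : ∀ {σ A} → Monomial σ A → ∀ B i j → (A ∙ B) i j ≈ A i (σ i) * B (σ i) j
  ∙-monomialˡ {σ} {A} A-mono B i j =
    Σ-support (σ i) (λ k → A i k * B k j) λ k k≢σi → trans (*-congʳ (A-mono i k k≢σi)) (zeroˡ (B k j))

  ∙-monomialʳ : ∀ {σ A} → (∀ k → σ (σ k) ≡ k) → Monomial σ A → ∀ B i j → (B ∙ A) i j ≈ B i (σ j) * A (σ j) j
  ∙-monomialʳ {σ} {A} σ-involutive A-mono B i j = Σ-support (σ j) (λ k → B i k * A k j) λ k k≢σj →
    trans (*-congˡ (A-mono k j λ j≡σk → k≢σj (≡.trans (≡.sym (σ-involutive k)) (≡.cong σ (≡.sym j≡σk))))) (zeroʳ (B i k))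

  E : Fin 4 → Fin 4 → Carrier → Mat
  E i j x k l = if ⌊ k Fin.≟ i ⌋ ∧ ⌊ l Fin.≟ j ⌋ then x else 0#

  E-on : ∀ i j x → E i j x i j ≡ x
  E-on i j x with i Fin.≟ i | j Fin.≟ j
  ... | yes _ | yes _ = ≡.refl
  ... | no i≢i | _ = ⊥-elim (i≢i ≡.refl)
  ... | yes _ | no j≢j = ⊥-elim (j≢j ≡.refl)

  E-off : ∀ {i j x k l} → k ≢ i ⊎ l ≢ j → E i j x k l ≡ 0#
  E-off {i} {j} {x} {k} {l} off with k Fin.≟ i | l Fin.≟ j
  ... | no _ | _ = ≡.refl
  ... | yes _ | no _ = ≡.refl
  ... | yes k≡i | yes l≡j with off
  ...   | inj₁ k≢i = ⊥-elim (k≢i k≡i)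
  ...   | inj₂ l≢j = ⊥-elim (l≢j l≡j)

  ∙E∙ : ∀ i j x A B a b → (A ∙ (E i j x ∙ B)) a b ≈ A a i * (x * B j b)
  ∙E∙ i j x A B a b = begin
    (Σ λ k → A a k * (E i j x ∙ B) k b) ≈⟨ Σ-support i (λ k → A a k * (E i j x ∙ B) k b) (λ k k≢i →
                                             trans (*-congˡ (EB-off k≢i)) (zeroʳ (A a k))) ⟩
    A a i * (E i j x ∙ B) i b           ≈⟨ *-congˡ (trans (EB i) (*-congʳ (reflexive (E-on i j x)))) ⟩
    A a i * (x * B j b)                 ∎
    where
    open ≈-Reasoning
    EB : ∀ k → (E i j x ∙ B) k b ≈ E i j x k j * B j b
    EB k = Σ-support j (λ l → E i j x k l * B l b) λ l l≢j → trans (*-congʳ (reflexive (E-off {i} {j} {x} {k} {l} (inj₂ l≢j)))) (zeroˡ (B l b))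
    EB-off : ∀ {k} → k ≢ i → (E i j x ∙ B) k b ≈ 0#
    EB-off {k} k≢i = trans (EB k) (trans (*-congʳ (reflexive (E-off {i} {j} {x} {k} {j} (inj₁ k≢i)))) (zeroˡ (B j b)))

  monomial-inverse : ∀ {σ A B} → (∀ k → σ (σ k) ≡ k) → Monomial σ A → Monomial σ B →
                     (∀ i → A i (σ i) * B (σ i) i ≈ 1#) → A ∙ B ≈M I
  monomial-inverse {σ} {A} {B} σ-involutive A-mono B-mono diagonal i j
    with ∙-monomialˡ A-mono B i j | i Fin.≟ j
  ... | AB≈ | yes ≡.refl = trans AB≈ (diagonal i)
  ... | AB≈ | no i≢j = trans AB≈ (trans (*-congˡ (B-mono (σ i) j j≢σσi)) (zeroʳ (A i (σ i))))
    where
    j≢σσi : j ≢ σ (σ i)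
    j≢σσi j≡σσi = i≢j (≡.trans (≡.sym (σ-involutive i)) (≡.sym j≡σσi))

  ≈M-setoid : Setoid c ℓ
  ≈M-setoid = record
    { Carrier = Mat
    ; _≈_ = _≈M_
    ; isEquivalence = record
      { refl = λ _ _ → refl
      ; sym = λ A≈B i j → sym (A≈B i j)
      ; trans = λ A≈B B≈C i j → trans (A≈B i j) (B≈C i j)
      }
    }

  monoid : Monoid c ℓ
  monoid = record
    { Carrier = Mat
    ; _≈_ = _≈M_
    ; _∙_ = _∙_
    ; ε = I
    ; isMonoid = record
      { isSemigroup = record
        { isMagma = record { isEquivalence = Setoid.isEquivalence ≈M-setoid ; ∙-cong = ∙-cong }
        ; assoc = ∙-assoc
        }
      ; identity = ∙-identityˡ , ∙-identityʳ
      }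
    }

  open Setoid ≈M-setoid public using () renaming (refl to ≈M-refl; sym to ≈M-sym; trans to ≈M-trans)
  private module ≈M-Reasoning = Relation.Binary.Reasoning.Setoid ≈M-setoid

  ∙-assoc⁻ : ∀ A B C → A ∙ (B ∙ C) ≈M (A ∙ B) ∙ C
  ∙-assoc⁻ A B C = ≈M-sym (∙-assoc A B C)

  ∙-congˡ : ∀ {A B B′} → B ≈M B′ → A ∙ B ≈M A ∙ B′
  ∙-congˡ = ∙-cong ≈M-refl

  ∙-congʳ : ∀ {A A′ B} → A ≈M A′ → A ∙ B ≈M A′ ∙ B
  ∙-congʳ A≈A′ = ∙-cong A≈A′ ≈M-refl

  inverse-unique : ∀ {u v w} → u ∙ v ≈M I → w ∙ u ≈M I → w ≈M v
  inverse-unique {u} {v} {w} uv≈I wu≈I = begin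
    w              ≈⟨ ≈M-sym (∙-identityʳ w) ⟩
    w ∙ I          ≈⟨ ∙-congˡ (≈M-sym uv≈I) ⟩
    w ∙ (u ∙ v)    ≈⟨ ∙-assoc⁻ w u v ⟩
    (w ∙ u) ∙ v    ≈⟨ ∙-congʳ wu≈I ⟩
    I ∙ v          ≈⟨ ∙-identityˡ v ⟩
    v              ∎
    where open ≈M-Reasoning

  conjugate-cancel : ∀ {u v} z → u ∙ v ≈M I → u ∙ ((v ∙ (z ∙ u)) ∙ v) ≈M z
  conjugate-cancel {u} {v} z uv≈I = begin
    u ∙ ((v ∙ (z ∙ u)) ∙ v)  ≈⟨ ∙-congˡ (∙-assoc v (z ∙ u) v) ⟩
    u ∙ (v ∙ ((z ∙ u) ∙ v))  ≈⟨ ∙-assoc⁻ u v ((z ∙ u) ∙ v) ⟩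
    (u ∙ v) ∙ ((z ∙ u) ∙ v)  ≈⟨ ∙-cong uv≈I (∙-assoc z u v) ⟩
    I ∙ (z ∙ (u ∙ v))        ≈⟨ ∙-identityˡ (z ∙ (u ∙ v)) ⟩
    z ∙ (u ∙ v)              ≈⟨ ∙-congˡ uv≈I ⟩
    z ∙ I                    ≈⟨ ∙-identityʳ z ⟩
    z                        ∎
    where open ≈M-Reasoning

  sandwich-∙ : ∀ A B C D z → (A ∙ C) ∙ (z ∙ (D ∙ B)) ≈M A ∙ ((C ∙ (z ∙ D)) ∙ B)
  sandwich-∙ A B C D z = begin
    (A ∙ C) ∙ (z ∙ (D ∙ B))  ≈⟨ ∙-assoc A C (z ∙ (D ∙ B)) ⟩
    A ∙ (C ∙ (z ∙ (D ∙ B)))  ≈⟨ ∙-congˡ (∙-congˡ (∙-assoc⁻ z D B)) ⟩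
    A ∙ (C ∙ ((z ∙ D) ∙ B))  ≈⟨ ∙-congˡ (∙-assoc⁻ C (z ∙ D) B) ⟩
    A ∙ ((C ∙ (z ∙ D)) ∙ B)  ∎
    where open ≈M-Reasoning

  scale-cancel : ∀ {x y} A → x * y ≈ 1# → scale x (scale y A) ≈M A
  scale-cancel {x} {y} A xy≈1 = begin
    scale x (scale y A)  ≈⟨ scale-scale x y A ⟩
    scale (x * y) A      ≈⟨ scale-cong xy≈1 ≈M-refl ⟩
    scale 1# A           ≈⟨ scale-identity A ⟩
    A                    ∎
    where open ≈M-Reasoning

  scale-sandwich : ∀ {x y} A z B → x * y ≈ 1# → scale x A ∙ (z ∙ scale y B) ≈M A ∙ (z ∙ B)
  scale-sandwich {x} {y} A z B xy≈1 = begin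
    scale x A ∙ (z ∙ scale y B)      ≈⟨ scale-∙ˡ x A (z ∙ scale y B) ⟩
    scale x (A ∙ (z ∙ scale y B))    ≈⟨ scale-cong refl (∙-congˡ (scale-∙ʳ y z B)) ⟩
    scale x (A ∙ scale y (z ∙ B))    ≈⟨ scale-cong refl (scale-∙ʳ y A (z ∙ B)) ⟩
    scale x (scale y (A ∙ (z ∙ B)))  ≈⟨ scale-cancel (A ∙ (z ∙ B)) xy≈1 ⟩
    A ∙ (z ∙ B)                      ∎
    where open ≈M-Reasoning

  scale-inverse : ∀ {x y A B} → x * y ≈ 1# → A ∙ B ≈M I → scale x A ∙ scale y B ≈M I
  scale-inverse {x} {y} {A} {B} xy≈1 AB≈I = begin
    scale x A ∙ scale y B      ≈⟨ scale-∙ˡ x A (scale y B) ⟩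
    scale x (A ∙ scale y B)    ≈⟨ scale-cong refl (scale-∙ʳ y A B) ⟩
    scale x (scale y (A ∙ B))  ≈⟨ scale-cancel (A ∙ B) xy≈1 ⟩
    A ∙ B                      ≈⟨ AB≈I ⟩
    I                          ∎
    where open ≈M-Reasoning

-- Discretely valued rings

-- The valuation is given by the predicates v(x) ≥ t, written x ∈π^ t (x ∈ π^t O), rather than by a
-- function, which would be undefined at 0.
record DiscreteValuation {c ℓ} (R : CommutativeRing c ℓ) : Set (lsuc 0ℓ ⊔ c ⊔ ℓ) where
  open CommutativeRing R hiding (_-_; -_)
  infix 8 π^_
  infix 4 _∈π^_
  field
    π^_         : ℤ → Carrier
    _∈π^_       : Carrier → ℤ → Set
    π^-+        : ∀ s t → π^ s * π^ t ≈ π^ (s ℤ.+ t)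
    π^0         : π^ + 0 ≈ 1#
    ∈-resp-≈    : ∀ {x y t} → x ≈ y → x ∈π^ t → y ∈π^ t
    ∈-weaken    : ∀ {x s t} → t ℤ.≤ s → x ∈π^ s → x ∈π^ t
    0∈π^        : ∀ t → 0# ∈π^ t
    π^∈π^       : ∀ t → π^ t ∈π^ t
    +-∈π^       : ∀ {x y t} → x ∈π^ t → y ∈π^ t → x + y ∈π^ t
    *-∈π^       : ∀ {x y s t} → x ∈π^ s → y ∈π^ t → x * y ∈π^ (s ℤ.+ t)
    *-∈π^-cancelˡ : ∀ {x y c m} → x * y ∈π^ c → ¬ x ∈π^ ℤ.suc m → y ∈π^ (c - m)
    1∉π^1       : ¬ 1# ∈π^ 1ℤ
    ∈π^-bounded : ∀ x → ∃ λ t → x ∈π^ t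
    _∈π^?_      : ∀ x t → Dec (x ∈π^ t)

module ValuationProperties {c ℓ} {R : CommutativeRing c ℓ} (V : DiscreteValuation R) where

  open import Data.Integer.Base using (_+_)
  open CommutativeRing R
    using (Carrier; _≈_; _*_; 1#; *-comm; *-assoc; *-congˡ; *-congʳ; *-identityˡ; sym; trans; reflexive)
  open DiscreteValuation V

  infix 4 _∉π^_
  _∉π^_ : Carrier → ℤ → Set
  x ∉π^ t = ¬ x ∈π^ t

  ∉-weaken : ∀ {x s t} → s ℤ.≤ t → x ∉π^ s → x ∉π^ t
  ∉-weaken s≤t x∉ x∈ = x∉ (∈-weaken s≤t x∈)

  ∈-∉-< : ∀ {x s t} → x ∈π^ s → x ∉π^ t → s ℤ.< t
  ∈-∉-< x∈ x∉ = ℤ.≰⇒> λ t≤s → x∉ (∈-weaken t≤s x∈)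

  *-∈π^-cancelʳ : ∀ {x y c m} → x * y ∈π^ c → y ∉π^ ℤ.suc m → x ∈π^ (c - m)
  *-∈π^-cancelʳ xy∈ = *-∈π^-cancelˡ (∈-resp-≈ (*-comm _ _) xy∈)

  π^-inverse : ∀ t → π^ t * π^ (- t) ≈ 1#
  π^-inverse t = trans (π^-+ t (- t)) (trans (reflexive (≡.cong π^_ (ℤ.+-inverseʳ t))) π^0)

  π^-inverseˡ : ∀ t → π^ (- t) * π^ t ≈ 1#
  π^-inverseˡ t = trans (*-comm _ _) (π^-inverse t)

  1∈π^0 : 1# ∈π^ + 0
  1∈π^0 = ∈-resp-≈ π^0 (π^∈π^ (+ 0))

  <suc⇒≤ : ∀ {i j} → i ℤ.< ℤ.suc j → i ℤ.≤ j
  <suc⇒≤ {i} {j} i<sj = ≡.subst (i ℤ.≤_) (pred-suc j) (ℤ.i<j⇒i≤pred[j] i<sj)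
    where
    pred-suc : ∀ j → -1ℤ + (1ℤ + j) ≡ j
    pred-suc = solve-∀

  ∈-∉-≤ : ∀ {x s t} → x ∈π^ s → x ∉π^ ℤ.suc t → s ℤ.≤ t
  ∈-∉-≤ x∈ x∉ = <suc⇒≤ (∈-∉-< x∈ x∉)

  exact-from-bounds : ∀ {x y a b s} → a + b ≡ + 0 → x ∈π^ a → y ∈π^ b →
                      x ∉π^ ℤ.suc s → y ∉π^ ℤ.suc (- s) → x ∉π^ ℤ.suc a × y ∉π^ ℤ.suc b
  exact-from-bounds {a = a} {b} {s} a+b≡0 x∈ y∈ x∉ y∉ =
    ∉-weaken (ℤ.suc-mono s≤a) x∉ , ∉-weaken (ℤ.suc-mono -s≤b) y∉
    where
    -b≡a : - b ≡ a
    -b≡a = ≡.trans (≡.sym (ℤ.+-identityˡ (- b))) (≡.trans (≡.cong (_+ - b) (≡.sym a+b≡0)) (cancel a b))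
      where
      cancel : ∀ a b → (a + b) + - b ≡ a
      cancel = solve-∀
    s≤a : s ℤ.≤ a
    s≤a = ≡.subst₂ ℤ._≤_ (ℤ.neg-involutive s) -b≡a (ℤ.neg-mono-≤ (∈-∉-≤ y∈ y∉))
    -s≤b : - s ℤ.≤ b
    -s≤b = ≡.subst (- s ℤ.≤_) (≡.trans (≡.cong -_ (≡.sym -b≡a)) (ℤ.neg-involutive b)) (ℤ.neg-mono-≤ (∈-∉-≤ x∈ x∉))

  exact-valuation : ∀ {x s t} → x ∈π^ s → x ∉π^ t → ∃ λ s′ → x ∈π^ s′ × x ∉π^ ℤ.suc s′
  exact-valuation {x} {s} {t} x∈ x∉ = search ℤ.∣ t - s ∣ x∈ (≡.subst (x ∉π^_) (≡.sym s+∣t-s∣≡t) x∉)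
    where
    s+∣t-s∣≡t : s + + ℤ.∣ t - s ∣ ≡ t
    s+∣t-s∣≡t = ≡.trans (≡.cong (_+_ s) (ℤ.0≤i⇒+∣i∣≡i (ℤ.i≤j⇒0≤j-i (ℤ.<⇒≤ (∈-∉-< x∈ x∉))))) (s+[t-s] s t)
      where
      s+[t-s] : ∀ s t → s + (t - s) ≡ t
      s+[t-s] = solve-∀
    search : ∀ f {s} → x ∈π^ s → x ∉π^ (s + + f) → ∃ λ s′ → x ∈π^ s′ × x ∉π^ ℤ.suc s′
    search zero {s} x∈ x∉ = ⊥-elim (x∉ (≡.subst (x ∈π^_) (≡.sym (ℤ.+-identityʳ s)) x∈))
    search (suc f) {s} x∈ x∉ with x ∈π^? ℤ.suc s
    ... | no x∉′ = s , x∈ , x∉′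
    ... | yes x∈′ = search f x∈′ (≡.subst (x ∉π^_) (shift s f) x∉)
      where
      shift : ∀ s f → s + + suc f ≡ ℤ.suc s + + f
      shift s f = ≡.trans (≡.cong (_+_ s) (ℤ.pos-+ 1 f)) (reassoc s (+ f))
        where
        reassoc : ∀ s f → s + (1ℤ + f) ≡ (1ℤ + s) + f
        reassoc = solve-∀

  product-split : ∀ {x y} → x * y ∉π^ 1ℤ → ∃ λ s → x ∈π^ s × x ∉π^ ℤ.suc s × y ∉π^ ℤ.suc (- s)
  product-split {x} {y} xy∉ =
    let ty , y∈ = ∈π^-bounded y
        _ , x∈ = ∈π^-bounded x
        s , x∈s , x∉s = exact-valuation x∈ (x∉ y∈)
    in s , x∈s , x∉s , λ y∈′ → xy∉ (≡.subst (x * y ∈π^_) (add-sub s) (*-∈π^ x∈s y∈′))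
    where
    sub-add : ∀ a b → (a - b) + b ≡ a
    sub-add = solve-∀
    add-sub : ∀ s → s + (1ℤ + - s) ≡ 1ℤ
    add-sub = solve-∀
    x∉ : ∀ {t} → y ∈π^ t → x ∉π^ (1ℤ - t)
    x∉ {t} y∈ x∈ = xy∉ (≡.subst (x * y ∈π^_) (sub-add 1ℤ t) (*-∈π^ x∈ y∈))

  ∉-scale : ∀ {x y c s} → y ≈ π^ c * x → x ∉π^ ℤ.suc s → y ∉π^ ℤ.suc (c + s)
  ∉-scale {x} {y} {c} {s} y≈ x∉ y∈ = x∉ (∈-resp-≈ cancel (≡.subst (π^ (- c) * y ∈π^_) (shift c s) (*-∈π^ (π^∈π^ (- c)) y∈)))
    where
    shift : ∀ c s → - c + (1ℤ + (c + s)) ≡ 1ℤ + s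
    shift = solve-∀
    cancel : π^ (- c) * y ≈ x
    cancel = trans (*-congˡ y≈) (trans (sym (*-assoc _ _ _))
               (trans (*-congʳ (trans (*-comm _ _) (π^-inverse c))) (*-identityˡ x)))

  ∉-resp-≈ : ∀ {x y t} → x ≈ y → x ∉π^ t → y ∉π^ t
  ∉-resp-≈ x≈y x∉ y∈ = x∉ (∈-resp-≈ (sym x≈y) y∈)

  *-∉π^1 : ∀ {x y s} → x ∉π^ ℤ.suc s → y ∉π^ ℤ.suc (- s) → x * y ∉π^ 1ℤ
  *-∉π^1 {s = s} x∉ y∉ xy∈ = y∉ (*-∈π^-cancelˡ {m = s} xy∈ x∉)

-- The order R and the normaliser theorem over a discretely valued ring

-- R_{ij} = π^{n · shape i j} O.
shape : Fin 4 → Fin 4 → ℤ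
shape 0F 1F = 1ℤ
shape 1F 3F = -1ℤ
shape 2F 1F = 1ℤ
shape 3F 0F = 1ℤ
shape 3F 1F = 1ℤ
shape 3F 2F = 1ℤ
shape _  _  = + 0

-- W is monomial with pattern σ and W_{i σ(i)} = π^{n · ω i}.
σ : Fin 4 → Fin 4
σ 0F = 1F
σ 1F = 0F
σ 2F = 3F
σ 3F = 2F

σ-involutive : ∀ i → σ (σ i) ≡ i
σ-involutive 0F = ≡.refl
σ-involutive 1F = ≡.refl
σ-involutive 2F = ≡.refl
σ-involutive 3F = ≡.refl

ω : Fin 4 → ℤ
ω 0F = 1ℤ
ω 1F = + 0
ω 2F = + 0
ω 3F = 1ℤ

-- The inequalities between exponents used below are all linear in n, so it suffices to check
-- them on the shape, which is done by exhaustion.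
shape-triangle : ∀ i k j → shape i j ℤ.≤ shape i k ℤ.+ shape k j
shape-triangle = toWitness {a? = all? λ i → all? λ k → all? λ j → shape i j ≤? shape i k ℤ.+ shape k j} _

shape-conj-W : ∀ i j → shape i j ℤ.≤ (- ω (σ i) ℤ.+ shape (σ i) (σ j)) ℤ.+ ω (σ j)
shape-conj-W = toWitness {a? = all? λ i → all? λ j → shape i j ≤? (- ω (σ i) ℤ.+ shape (σ i) (σ j)) ℤ.+ ω (σ j)} _

shape-conj-W⁻¹ : ∀ i j → shape i j ℤ.≤ (ω i ℤ.+ shape (σ i) (σ j)) - ω j
shape-conj-W⁻¹ = toWitness {a? = all? λ i → all? λ j → shape i j ≤? (ω i ℤ.+ shape (σ i) (σ j)) - ω j} _

private
  +-sub-shift : ∀ k x d → k ℤ.+ (x - d) ≡ x - (- k ℤ.+ d)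
  +-sub-shift = solve-∀

  neg-+-sub-shift : ∀ k x d → - k ℤ.+ (x - d) ≡ x - (k ℤ.+ d)
  neg-+-sub-shift = solve-∀

  +-neg-cancel : ∀ k x y → (k ℤ.+ x) ℤ.+ (- k ℤ.+ y) ≡ x ℤ.+ y
  +-neg-cancel = solve-∀

  +-sub-neg-sub-cancel : ∀ s a b → s ℤ.+ (a - - (b - s)) ≡ a ℤ.+ b
  +-sub-neg-sub-cancel = solve-∀

  linear-sum-diff : ∀ a b c d N → (a ℤ.* N - b ℤ.* N) ℤ.+ (c ℤ.* N - d ℤ.* N) ≡ ((a - b) ℤ.+ (c - d)) ℤ.* N
  linear-sum-diff = solve-∀

zero⊎positive : ∀ m → m ≡ 0 ⊎ 1 ℕ.≤ m
zero⊎positive zero = inj₁ ≡.refl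
zero⊎positive (suc m) = inj₂ (ℕ.s≤s ℕ.z≤n)

evenIx oddIx : Fin 2 → Fin 4
evenIx 0F = 0F
evenIx 1F = 2F
oddIx 0F = 1F
oddIx 1F = 3F

data Parity : Fin 4 → Set where
  even : ∀ i → Parity (evenIx i)
  odd  : ∀ i → Parity (oddIx i)

parity : ∀ i → Parity i
parity 0F = even 0F
parity 1F = odd 0F
parity 2F = even 1F
parity 3F = odd 1F

shape-even-row : ∀ i → shape 0F (evenIx i) ≡ + 0 × shape (evenIx i) 0F ≡ + 0
shape-even-row 0F = ≡.refl , ≡.refl
shape-even-row 1F = ≡.refl , ≡.refl

shape-h-pivot : ∀ i₀ I → shape I 1F ℤ.≤ (shape 0F 1F - shape (evenIx i₀) I) - shape 0F (evenIx i₀)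
shape-h-pivot = toWitness {a? = all? λ i₀ → all? λ I → shape I 1F ≤? (shape 0F 1F - shape (evenIx i₀) I) - shape 0F (evenIx i₀)} _

shape-g-pivot-odd : ∀ i₀ i₁ → let I₀ = evenIx i₀; I₁ = oddIx i₁ in
  shape 1F I₁ ℤ.≤ (shape I₀ I₁ - shape 0F 1F) - shape I₀ 0F
shape-g-pivot-odd = toWitness {a? = all? λ i₀ → all? λ i₁ →
  shape 1F (oddIx i₁) ≤? (shape (evenIx i₀) (oddIx i₁) - shape 0F 1F) - shape (evenIx i₀) 0F} _

shape-g-pivot-even : ∀ i₀ i₁ → let I₀ = evenIx i₀; I₁ = evenIx i₁ in
  shape 1F I₁ ℤ.≤ (shape 1F 0F - shape I₁ I₀) - shape I₀ 0F
shape-g-pivot-even = toWitness {a? = all? λ i₀ → all? λ i₁ →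
  shape 1F (evenIx i₁) ≤? (shape 1F 0F - shape (evenIx i₁) (evenIx i₀)) - shape (evenIx i₀) 0F} _

shape-odd-antisymmetric : ∀ i → shape 1F (oddIx i) ℤ.+ shape (oddIx i) 1F ≡ + 0
shape-odd-antisymmetric 0F = ≡.refl
shape-odd-antisymmetric 1F = ≡.refl

shape-even-loop : ∀ i → shape 1F (evenIx i) ℤ.+ shape (evenIx i) 1F ≡ 1ℤ
shape-even-loop 0F = ≡.refl
shape-even-loop 1F = ≡.refl

shape-odd-loop : ∀ i₀ i₁ → let I₀ = oddIx i₀; I₁ = oddIx i₁ in
  (shape 0F 1F - shape I₀ I₁) ℤ.+ (shape 1F 0F - shape I₁ I₀) ≡ 1ℤ
shape-odd-loop 0F 0F = ≡.refl
shape-odd-loop 0F 1F = ≡.refl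
shape-odd-loop 1F 0F = ≡.refl
shape-odd-loop 1F 1F = ≡.refl

shape-g-cover : ∀ i₀ i₁ j b → let I₀ = evenIx i₀; I₁ = oddIx i₁ in
  shape j b ℤ.≤ (shape I₀ b - shape 0F j) - shape I₀ 0F ⊎ shape j b ℤ.≤ (shape I₁ b - shape 1F j) - shape I₁ 1F
shape-g-cover = toWitness {a? = all? λ i₀ → all? λ i₁ → all? λ j → all? λ b →
  (shape j b ≤? (shape (evenIx i₀) b - shape 0F j) - shape (evenIx i₀) 0F) ⊎-dec
  (shape j b ≤? (shape (oddIx i₁) b - shape 1F j) - shape (oddIx i₁) 1F)} _

shape-h-cover : ∀ i₀ i₁ j b → let I₀ = evenIx i₀; I₁ = oddIx i₁ in
  shape j b ℤ.≤ (shape 0F b - shape I₀ j) - shape 0F I₀ ⊎ shape j b ℤ.≤ (shape 1F b - shape I₁ j) - shape 1F I₁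
shape-h-cover = toWitness {a? = all? λ i₀ → all? λ i₁ → all? λ j → all? λ b →
  (shape j b ≤? (shape 0F b - shape (evenIx i₀) j) - shape 0F (evenIx i₀)) ⊎-dec
  (shape j b ≤? (shape 1F b - shape (oddIx i₁) j) - shape 1F (oddIx i₁))} _

-- The exponent matrix e of R is a parameter, so that Defs.Rexp can be used for it verbatim.
module Normaliser {c ℓ} {R : CommutativeRing c ℓ} (V : DiscreteValuation R) (n : ℕ)
                  (e : Fin 4 → Fin 4 → ℤ) (e≡shape : ∀ i j → e i j ≡ shape i j ℤ.* + n) where

  open CommutativeRing R hiding (_-_; -_)
  open DiscreteValuation V
  open ValuationProperties V
  open Matrix4 R

  N : ℤ
  N = + n

  InR : Mat → Set
  InR x = ∀ i j → x i j ∈π^ e i j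

  IsUnitR : Mat → Set (c ⊔ ℓ)
  IsUnitR r = InR r × (∃ λ r′ → InR r′ × (r ∙ r′ ≈M I) × (r′ ∙ r ≈M I))

  W : Mat
  W 0F 1F = π^ N
  W 1F 0F = 1#
  W 2F 3F = 1#
  W 3F 2F = π^ N
  W _  _  = 0#

  W^ : Bool → Mat
  W^ false = I
  W^ true  = W

  Normalises : Mat → Mat → Set (c ⊔ ℓ)
  Normalises g h =
    (∀ x → InR x → InR (h ∙ (x ∙ g))) ×
    (∀ y → InR y → ∃ λ x → InR x × (y ≈M (h ∙ (x ∙ g))))

  InUnion : Mat → Set (c ⊔ ℓ)
  InUnion g = ∃ λ (k : ℤ) → ∃ λ (μ : Bool) → ∃ λ r → IsUnitR r × (g ≈M scale (π^ k) (W^ μ ∙ r))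

  W⁻¹ : Mat
  W⁻¹ 0F 1F = 1#
  W⁻¹ 1F 0F = π^ (- N)
  W⁻¹ 2F 3F = π^ (- N)
  W⁻¹ 3F 2F = 1#
  W⁻¹ _  _  = 0#

  W⁻^ : Bool → Mat
  W⁻^ false = I
  W⁻^ true  = W⁻¹

  e-scaled-≤ : ∀ {c d} → c ℤ.≤ d → c ℤ.* N ℤ.≤ d ℤ.* N
  e-scaled-≤ = ℤ.*-monoʳ-≤-nonNeg N

  InR-resp-≈M : ∀ {A B} → A ≈M B → InR A → InR B
  InR-resp-≈M A≈B A∈R i j = ∈-resp-≈ (A≈B i j) (A∈R i j)

  Σ-∈π^ : ∀ {f t} → (∀ k → f k ∈π^ t) → Σ f ∈π^ t
  Σ-∈π^ {f} {t} f∈ = ≡.subst (_∈π^ t) (≡.sym (Σ-expand f)) (+-∈π^ (+-∈π^ (+-∈π^ (f∈ 0F) (f∈ 1F)) (f∈ 2F)) (f∈ 3F))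

  Σ-∉π^ : ∀ {f t} → Σ f ∉π^ t → ∃ λ k → f k ∉π^ t
  Σ-∉π^ {f} {t} Σ∉ with f 0F ∈π^? t | f 1F ∈π^? t | f 2F ∈π^? t | f 3F ∈π^? t
  ... | no f₀∉ | _ | _ | _ = 0F , f₀∉
  ... | yes _ | no f₁∉ | _ | _ = 1F , f₁∉
  ... | yes _ | yes _ | no f₂∉ | _ = 2F , f₂∉
  ... | yes _ | yes _ | yes _ | no f₃∉ = 3F , f₃∉
  ... | yes f₀∈ | yes f₁∈ | yes f₂∈ | yes f₃∈ =
    ⊥-elim (Σ∉ (≡.subst (_∈π^ t) (≡.sym (Σ-expand f)) (+-∈π^ (+-∈π^ (+-∈π^ f₀∈ f₁∈) f₂∈) f₃∈)))

  e-triangle : ∀ i k j → e i j ℤ.≤ e i k ℤ.+ e k j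
  e-triangle i k j = ≡.subst₂ ℤ._≤_ (≡.sym (e≡shape i j))
    (≡.trans (ℤ.*-distribʳ-+ N (shape i k) (shape k j)) (≡.sym (≡.cong₂ ℤ._+_ (e≡shape i k) (e≡shape k j))))
    (e-scaled-≤ (shape-triangle i k j))

  ∙-InR : ∀ {A B} → InR A → InR B → InR (A ∙ B)
  ∙-InR A∈R B∈R i j = Σ-∈π^ λ k → ∈-weaken (e-triangle i k j) (*-∈π^ (A∈R i k) (B∈R k j))

  E-InR : ∀ i j → InR (E i j (π^ e i j))
  E-InR i j k l with k Fin.≟ i | l Fin.≟ j
  ... | yes ≡.refl | yes ≡.refl = π^∈π^ (e k l)
  ... | yes _ | no _ = 0∈π^ (e k l)
  ... | no _ | _ = 0∈π^ (e k l)

  W-monomial : Monomial σ W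
  W-monomial 0F = λ { 0F _ → refl ; 1F k≢σi → ⊥-elim (k≢σi ≡.refl) ; 2F _ → refl ; 3F _ → refl }
  W-monomial 1F = λ { 0F k≢σi → ⊥-elim (k≢σi ≡.refl) ; 1F _ → refl ; 2F _ → refl ; 3F _ → refl }
  W-monomial 2F = λ { 0F _ → refl ; 1F _ → refl ; 2F _ → refl ; 3F k≢σi → ⊥-elim (k≢σi ≡.refl) }
  W-monomial 3F = λ { 0F _ → refl ; 1F _ → refl ; 2F k≢σi → ⊥-elim (k≢σi ≡.refl) ; 3F _ → refl }

  W⁻¹-monomial : Monomial σ W⁻¹
  W⁻¹-monomial 0F = λ { 0F _ → refl ; 1F k≢σi → ⊥-elim (k≢σi ≡.refl) ; 2F _ → refl ; 3F _ → refl }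
  W⁻¹-monomial 1F = λ { 0F k≢σi → ⊥-elim (k≢σi ≡.refl) ; 1F _ → refl ; 2F _ → refl ; 3F _ → refl }
  W⁻¹-monomial 2F = λ { 0F _ → refl ; 1F _ → refl ; 2F _ → refl ; 3F k≢σi → ⊥-elim (k≢σi ≡.refl) }
  W⁻¹-monomial 3F = λ { 0F _ → refl ; 1F _ → refl ; 2F k≢σi → ⊥-elim (k≢σi ≡.refl) ; 3F _ → refl }

  W∙W⁻¹ : W ∙ W⁻¹ ≈M I
  W∙W⁻¹ = monomial-inverse σ-involutive W-monomial W⁻¹-monomial λ where
    0F → π^-inverse N
    1F → *-identityˡ 1#
    2F → *-identityˡ 1#
    3F → π^-inverse N

  W⁻¹∙W : W⁻¹ ∙ W ≈M I
  W⁻¹∙W = monomial-inverse σ-involutive W⁻¹-monomial W-monomial λ where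
    0F → *-identityˡ 1#
    1F → trans (*-comm _ _) (π^-inverse N)
    2F → trans (*-comm _ _) (π^-inverse N)
    3F → *-identityˡ 1#

  W^∙W⁻^ : ∀ μ → W^ μ ∙ W⁻^ μ ≈M I
  W^∙W⁻^ false = ∙-identityˡ I
  W^∙W⁻^ true = W∙W⁻¹

  W-entry-∈ : ∀ i → W i (σ i) ∈π^ (ω i ℤ.* N)
  W-entry-∈ 0F = ≡.subst (π^ N ∈π^_) (≡.sym (ℤ.*-identityˡ N)) (π^∈π^ N)
  W-entry-∈ 1F = 1∈π^0
  W-entry-∈ 2F = 1∈π^0
  W-entry-∈ 3F = ≡.subst (π^ N ∈π^_) (≡.sym (ℤ.*-identityˡ N)) (π^∈π^ N)

  W⁻¹-entry-∈ : ∀ i → W⁻¹ i (σ i) ∈π^ (- (ω (σ i) ℤ.* N))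
  W⁻¹-entry-∈ 0F = 1∈π^0
  W⁻¹-entry-∈ 1F = ≡.subst (λ t → π^ (- N) ∈π^ - t) (≡.sym (ℤ.*-identityˡ N)) (π^∈π^ (- N))
  W⁻¹-entry-∈ 2F = ≡.subst (λ t → π^ (- N) ∈π^ - t) (≡.sym (ℤ.*-identityˡ N)) (π^∈π^ (- N))
  W⁻¹-entry-∈ 3F = 1∈π^0

  InR-scale : ∀ {s t G} → t ℤ.+ s ≡ + 0 → (∀ j b → G j b ∈π^ (s ℤ.+ e j b)) → InR (scale (π^ t) G)
  InR-scale {s} {t} t+s≡0 G∈ j b = ≡.subst (_ ∈π^_) (cancel (e j b)) (*-∈π^ (π^∈π^ t) (G∈ j b))
    where
    cancel : ∀ x → t ℤ.+ (s ℤ.+ x) ≡ x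
    cancel x = ≡.trans (≡.sym (ℤ.+-assoc t s x)) (≡.trans (≡.cong (ℤ._+ x) t+s≡0) (ℤ.+-identityˡ x))

  Stable : Mat → Mat → Set c
  Stable A B = ∀ x → InR x → InR (A ∙ (x ∙ B))

  Stable-resp : ∀ {A A′ B B′} → A ≈M A′ → B ≈M B′ → Stable A B → Stable A′ B′
  Stable-resp A≈A′ B≈B′ st x x∈ = InR-resp-≈M (∙-cong A≈A′ (∙-congˡ B≈B′)) (st x x∈)

  Stable-∙ : ∀ {A B C D} → Stable A B → Stable C D → Stable (A ∙ C) (D ∙ B)
  Stable-∙ {A} {B} {C} {D} st-AB st-CD x x∈ = InR-resp-≈M (≈M-sym (sandwich-∙ A B C D x)) (st-AB _ (st-CD x x∈))

  Stable-scale : ∀ {x y A B} → x * y ≈ 1# → Stable A B → Stable (scale x A) (scale y B)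
  Stable-scale {A = A} {B} xy≈1 st z z∈ = InR-resp-≈M (≈M-sym (scale-sandwich A z B xy≈1)) (st z z∈)

  Stable-InR : ∀ {A B} → InR A → InR B → Stable A B
  Stable-InR A∈ B∈ x x∈ = ∙-InR A∈ (∙-InR x∈ B∈)

  Stable-I : Stable I I
  Stable-I x = InR-resp-≈M (≈M-sym (≈M-trans (∙-identityˡ (x ∙ I)) (∙-identityʳ x)))

  Stable-W⁻¹-W : Stable W⁻¹ W
  Stable-W⁻¹-W x x∈ i j = ∈-resp-≈ (sym entry) (∈-weaken e≤ (*-∈π^ (W⁻¹-entry-∈ i) (*-∈π^ (x∈ (σ i) (σ j)) W∈)))
    where
    entry : (W⁻¹ ∙ (x ∙ W)) i j ≈ W⁻¹ i (σ i) * (x (σ i) (σ j) * W (σ j) j)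
    entry = trans (∙-monomialˡ W⁻¹-monomial (x ∙ W) i j)
                  (*-congˡ (∙-monomialʳ σ-involutive W-monomial x (σ i) j))
    W∈ : W (σ j) j ∈π^ (ω (σ j) ℤ.* N)
    W∈ = ≡.subst (λ k → W (σ j) k ∈π^ (ω (σ j) ℤ.* N)) (σ-involutive j) (W-entry-∈ (σ j))
    linear : ∀ a b c N → ((- a ℤ.+ b) ℤ.+ c) ℤ.* N ≡ - (a ℤ.* N) ℤ.+ (b ℤ.* N ℤ.+ c ℤ.* N)
    linear = solve-∀
    e≤ : e i j ℤ.≤ - (ω (σ i) ℤ.* N) ℤ.+ (e (σ i) (σ j) ℤ.+ ω (σ j) ℤ.* N)
    e≤ = ≡.subst₂ ℤ._≤_ (≡.sym (e≡shape i j))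
           (≡.trans (linear (ω (σ i)) (shape (σ i) (σ j)) (ω (σ j)) N)
                    (≡.cong (λ t → - (ω (σ i) ℤ.* N) ℤ.+ (t ℤ.+ ω (σ j) ℤ.* N)) (≡.sym (e≡shape (σ i) (σ j)))))
           (e-scaled-≤ (shape-conj-W i j))

  Stable-W-W⁻¹ : Stable W W⁻¹
  Stable-W-W⁻¹ x x∈ i j = ∈-resp-≈ (sym entry) (∈-weaken e≤ (*-∈π^ (W-entry-∈ i) (*-∈π^ (x∈ (σ i) (σ j)) W⁻¹∈)))
    where
    entry : (W ∙ (x ∙ W⁻¹)) i j ≈ W i (σ i) * (x (σ i) (σ j) * W⁻¹ (σ j) j)
    entry = trans (∙-monomialˡ W-monomial (x ∙ W⁻¹) i j)
                  (*-congˡ (∙-monomialʳ σ-involutive W⁻¹-monomial x (σ i) j))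
    W⁻¹∈ : W⁻¹ (σ j) j ∈π^ (- (ω j ℤ.* N))
    W⁻¹∈ = ≡.subst (λ k → W⁻¹ (σ j) k ∈π^ - (ω k ℤ.* N)) (σ-involutive j) (W⁻¹-entry-∈ (σ j))
    linear : ∀ a b c N → ((a ℤ.+ b) - c) ℤ.* N ≡ a ℤ.* N ℤ.+ (b ℤ.* N ℤ.+ - (c ℤ.* N))
    linear = solve-∀
    e≤ : e i j ℤ.≤ ω i ℤ.* N ℤ.+ (e (σ i) (σ j) ℤ.+ - (ω j ℤ.* N))
    e≤ = ≡.subst₂ ℤ._≤_ (≡.sym (e≡shape i j))
           (≡.trans (linear (ω i) (shape (σ i) (σ j)) (ω j) N)
                    (≡.cong (λ t → ω i ℤ.* N ℤ.+ (t ℤ.+ - (ω j ℤ.* N))) (≡.sym (e≡shape (σ i) (σ j)))))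
           (e-scaled-≤ (shape-conj-W⁻¹ i j))

  Stable-W^ : ∀ μ → Stable (W^ μ) (W⁻^ μ)
  Stable-W^ false = Stable-I
  Stable-W^ true = Stable-W-W⁻¹

  Stable-W⁻^ : ∀ μ → Stable (W⁻^ μ) (W^ μ)
  Stable-W⁻^ false = Stable-I
  Stable-W⁻^ true = Stable-W⁻¹-W

  -- Conjugating the matrix unit π^{e i j} E i j ∈ R isolates the product of one entry of A and one of B.
  Stable-entry : ∀ {A B} → Stable A B → ∀ a i j b → A a i * B j b ∈π^ (e a b - e i j)
  Stable-entry {A} {B} st a i j b =
    ∈-resp-≈ cancel (*-∈π^ (∈-resp-≈ (∙E∙ i j (π^ e i j) A B a b) (st _ (E-InR i j) a b)) (π^∈π^ (- e i j)))
    where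
    open import Algebra.Properties.CommutativeSemigroup *-commutativeSemigroup using (xy∙z≈y∙xz)
    cancel : (A a i * (π^ e i j * B j b)) * π^ (- e i j) ≈ A a i * B j b
    cancel = trans (*-assoc _ _ _) (*-congˡ (trans (xy∙z≈y∙xz _ _ _) (trans (*-congˡ (π^-inverse (e i j))) (*-identityʳ _))))

  normalises⇔stable : ∀ {g h} → g ∙ h ≈M I → h ∙ g ≈M I → Normalises g h ⇔ (Stable h g × Stable g h)
  normalises⇔stable {g} {h} gh≈I hg≈I = mk⇔ to from
    where
    to : Normalises g h → Stable h g × Stable g h
    to (hRg⊆R , R⊆hRg) = hRg⊆R , λ y y∈ → conjugate (R⊆hRg y y∈)
      where
      conjugate : ∀ {y} → (∃ λ x → InR x × (y ≈M h ∙ (x ∙ g))) → InR (g ∙ (y ∙ h))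
      conjugate (x , x∈ , y≈) = InR-resp-≈M (≈M-sym (≈M-trans (∙-congˡ (∙-congʳ y≈)) (conjugate-cancel x gh≈I))) x∈
    from : Stable h g × Stable g h → Normalises g h
    from (st-hg , st-gh) = st-hg , λ y y∈ → g ∙ (y ∙ h) , st-gh y y∈ , ≈M-sym (conjugate-cancel y hg≈I)

  InUnion⇒Stable : ∀ {g h} → h ∙ g ≈M I → InUnion g → Stable h g × Stable g h
  InUnion⇒Stable {g} {h} hg≈I (k , μ , r , (r∈ , r′ , r′∈ , rr′≈I , _) , g≈) =
    Stable-resp (≈M-sym h≈) (≈M-sym g≈) (Stable-scale (π^-inverseˡ k) (Stable-∙ (Stable-InR r′∈ r∈) (Stable-W⁻^ μ))) ,
    Stable-resp (≈M-sym g≈) (≈M-sym h≈) (Stable-scale (π^-inverse k) (Stable-∙ (Stable-W^ μ) (Stable-InR r∈ r′∈)))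
    where
    open import Algebra.Properties.Monoid monoid using (cancelᶜ)
    h≈ : h ≈M scale (π^ (- k)) (r′ ∙ W⁻^ μ)
    h≈ = inverse-unique (scale-inverse (π^-inverse k) (≈M-trans (cancelᶜ rr′≈I (W^ μ) (W⁻^ μ)) (W^∙W⁻^ μ)))
                        (≈M-trans (∙-congˡ (≈M-sym g≈)) hg≈I)

  scaled-InUnion : ∀ {g G H} k μ → G ∙ H ≈M I → H ∙ G ≈M I →
    (∀ j b → G j b ∈π^ (k ℤ.+ e j b)) → (∀ j b → H j b ∈π^ (- k ℤ.+ e j b)) →
    g ≈M W^ μ ∙ G → InUnion g
  scaled-InUnion {g} {G} {H} k μ GH≈I HG≈I G∈ H∈ g≈ =
    k , μ , scale (π^ (- k)) G ,
    (InR-scale (ℤ.+-inverseˡ k) G∈ , scale (π^ k) H , InR-scale (ℤ.+-inverseʳ k) H∈ ,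
     scale-inverse (π^-inverseˡ k) GH≈I , scale-inverse (π^-inverse k) HG≈I) ,
    ≈M-trans g≈ (≈M-trans (∙-congˡ (≈M-sym (scale-cancel G (π^-inverse k)))) (scale-∙ʳ (π^ k) (W^ μ) (scale (π^ (- k)) G)))

  e≡0 : ∀ {x y} → shape x y ≡ + 0 → e x y ≡ + 0
  e≡0 {x} {y} shape≡0 = ≡.trans (e≡shape x y) (≡.cong (ℤ._* N) shape≡0)

  e-linear : ∀ u v w z p q → (e u v - e w z) - e p q ≡ ((shape u v - shape w z) - shape p q) ℤ.* N
  e-linear u v w z p q rewrite e≡shape u v | e≡shape w z | e≡shape p q = linear (shape u v) (shape w z) (shape p q) N
    where
    linear : ∀ a b c N → (a ℤ.* N - b ℤ.* N) - c ℤ.* N ≡ ((a - b) - c) ℤ.* N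
    linear = solve-∀

  e-≤ : ∀ {x y u v w z p q} → shape x y ℤ.≤ (shape u v - shape w z) - shape p q → e x y ℤ.≤ (e u v - e w z) - e p q
  e-≤ {x} {y} {u} {v} {w} {z} {p} {q} ≤shape =
    ≡.subst₂ ℤ._≤_ (≡.sym (e≡shape x y)) (≡.sym (e-linear u v w z p q)) (e-scaled-≤ ≤shape)

  e-sum : ∀ x y u v → e x y ℤ.+ e u v ≡ (shape x y ℤ.+ shape u v) ℤ.* N
  e-sum x y u v rewrite e≡shape x y | e≡shape u v = ≡.sym (ℤ.*-distribʳ-+ N (shape x y) (shape u v))

  e-sum-diff : ∀ u v w z p q r t → (e u v - e w z) ℤ.+ (e p q - e r t) ≡ ((shape u v - shape w z) ℤ.+ (shape p q - shape r t)) ℤ.* N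
  e-sum-diff u v w z p q r t =
    ≡.trans (≡.cong₂ ℤ._+_ (≡.cong₂ _-_ (e≡shape u v) (e≡shape w z)) (≡.cong₂ _-_ (e≡shape p q) (e≡shape r t)))
            (linear-sum-diff (shape u v) (shape w z) (shape p q) (shape r t) N)

  e-zero : n ≡ 0 → ∀ x y → e x y ≡ + 0
  e-zero n≡0 x y = ≡.trans (e≡shape x y) (≡.trans (≡.cong (λ m → shape x y ℤ.* + m) n≡0) (ℤ.*-zeroʳ (shape x y)))

  module Pivoting {g h : Mat} (g∙h≈I : g ∙ h ≈M I) (st-hg : Stable h g) (st-gh : Stable g h) where

    record Pivot (a I : Fin 4) : Set where
      constructor pivot
      field
        val : ℤ
        g∈  : g a I ∈π^ val
        g∉  : g a I ∉π^ ℤ.suc val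
        h∉  : h I a ∉π^ ℤ.suc (- val)

    gh∉ : ∀ a → Σ (λ k → g a k * h k a) ∉π^ 1ℤ
    gh∉ a gh∈ = 1∉π^1 (∈-resp-≈ (trans (g∙h≈I a a) (reflexive (I-diagonal a))) gh∈)

    pivot-exists : ∀ a → ∃ (Pivot a)
    pivot-exists a =
      let i , gh∉ᵢ = Σ-∉π^ (gh∉ a)
          s , g∈ , g∉ , h∉ = product-split gh∉ᵢ
      in i , pivot s g∈ g∉ h∉

    g-bound : ∀ {a I m} → h I a ∉π^ ℤ.suc m → ∀ j b → g j b ∈π^ ((e I b - e a j) - m)
    g-bound {a} {I} {m} h∉ j b = *-∈π^-cancelˡ {m = m} (Stable-entry st-hg I a j b) h∉

    g-bound′ : ∀ {a I m} → h I a ∉π^ ℤ.suc m → ∀ j b → g j b ∈π^ ((e j a - e b I) - m)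
    g-bound′ {a} {I} {m} h∉ j b = *-∈π^-cancelʳ {m = m} (Stable-entry st-gh j b I a) h∉

    h-bound : ∀ {a I m} → g a I ∉π^ ℤ.suc m → ∀ j b → h j b ∈π^ ((e a b - e I j) - m)
    h-bound {a} {I} {m} g∉ j b = *-∈π^-cancelˡ {m = m} (Stable-entry st-gh a I j b) g∉

    -- Bounds through a balanced pivot place g in π^k R and h in π^{-k} R wherever the exponents allow.
    record Balanced (k : ℤ) (a I : Fin 4) : Set where
      constructor balanced
      field
        g∉ : g a I ∉π^ ℤ.suc (k ℤ.+ e a I)
        h∉ : h I a ∉π^ ℤ.suc (- k ℤ.+ e I a)

    balanced-g : ∀ {k a I} → Balanced k a I → ∀ {j b} → e j b ℤ.≤ (e I b - e a j) - e I a → g j b ∈π^ (k ℤ.+ e j b)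
    balanced-g {k} {a} {I} (balanced _ h∉) {j} {b} e≤ =
      ∈-weaken (≡.subst (k ℤ.+ e j b ℤ.≤_) (+-sub-shift k (e I b - e a j) (e I a)) (ℤ.+-monoʳ-≤ k e≤))
               (g-bound {m = - k ℤ.+ e I a} h∉ j b)

    balanced-g′ : ∀ {k a I} → Balanced k a I → ∀ {j b} → e j b ℤ.≤ (e j a - e b I) - e I a → g j b ∈π^ (k ℤ.+ e j b)
    balanced-g′ {k} {a} {I} (balanced _ h∉) {j} {b} e≤ =
      ∈-weaken (≡.subst (k ℤ.+ e j b ℤ.≤_) (+-sub-shift k (e j a - e b I) (e I a)) (ℤ.+-monoʳ-≤ k e≤))
               (g-bound′ {m = - k ℤ.+ e I a} h∉ j b)

    balanced-h : ∀ {k a I} → Balanced k a I → ∀ {j b} → e j b ℤ.≤ (e a b - e I j) - e a I → h j b ∈π^ (- k ℤ.+ e j b)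
    balanced-h {k} {a} {I} (balanced g∉ _) {j} {b} e≤ =
      ∈-weaken (≡.subst (- k ℤ.+ e j b ℤ.≤_) (neg-+-sub-shift k (e a b - e I j) (e a I)) (ℤ.+-monoʳ-≤ (- k) e≤))
               (h-bound {m = k ℤ.+ e a I} g∉ j b)

    pivot-balanced : ∀ {a I} (P : Pivot a I) → e a I ≡ + 0 → e I a ≡ + 0 → Balanced (Pivot.val P) a I
    pivot-balanced {a} {I} (pivot s _ g∉ h∉) e₁≡0 e₂≡0 = balanced
      (≡.subst (λ t → g a I ∉π^ ℤ.suc t) (≡.sym (≡.trans (≡.cong (ℤ._+_ s) e₁≡0) (ℤ.+-identityʳ s))) g∉)
      (≡.subst (λ t → h I a ∉π^ ℤ.suc t) (≡.sym (≡.trans (≡.cong (ℤ._+_ (- s)) e₂≡0) (ℤ.+-identityʳ (- s)))) h∉)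

    -- With the row-0 pivot in an even column and the row-1 pivot in an odd one, the two balanced
    -- pairs together bound every entry of g and of h.
    module EvenOdd {k i₀ i₁ s₁} (b₀ : Balanced k 0F (evenIx i₀))
                   (g₁∉ : g 1F (oddIx i₁) ∉π^ ℤ.suc s₁) (h₁∉ : h (oddIx i₁) 1F ∉π^ ℤ.suc (- s₁)) where

      private
        I₁ = oddIx i₁

      b₁ : Balanced k 1F I₁
      b₁ = uncurry balanced (exact-from-bounds {s = s₁} sum≡0
             (balanced-g b₀ (e-≤ (shape-g-pivot-odd i₀ i₁))) (balanced-h b₀ (e-≤ (shape-h-pivot i₀ I₁))) g₁∉ h₁∉)
        where
        sum≡0 : (k ℤ.+ e 1F I₁) ℤ.+ (- k ℤ.+ e I₁ 1F) ≡ + 0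
        sum≡0 = ≡.trans (+-neg-cancel k _ _) (≡.trans (e-sum 1F I₁ I₁ 1F) (≡.cong (ℤ._* N) (shape-odd-antisymmetric i₁)))

      g-scaled : ∀ j b → g j b ∈π^ (k ℤ.+ e j b)
      g-scaled j b =
        [ (λ ≤shape → balanced-g b₀ (e-≤ ≤shape)) , (λ ≤shape → balanced-g b₁ (e-≤ ≤shape)) ]′ (shape-g-cover i₀ i₁ j b)

      h-scaled : ∀ j b → h j b ∈π^ (- k ℤ.+ e j b)
      h-scaled j b =
        [ (λ ≤shape → balanced-h b₀ (e-≤ ≤shape)) , (λ ≤shape → balanced-h b₁ (e-≤ ≤shape)) ]′ (shape-h-cover i₀ i₁ j b)

    1≤N : 1 ℕ.≤ n → 1ℤ ℤ.≤ 1ℤ ℤ.* N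
    1≤N 1≤n = ≡.subst (1ℤ ℤ.≤_) (≡.sym (ℤ.*-identityˡ N)) (ℤ.+≤+ 1≤n)

    -- Here the row-1 pivot product g_{1I} h_{I1} would lie in π^n O.
    even-even-absurd : ∀ {k i₀ i₁ s₁} → 1 ℕ.≤ n → Balanced k 0F (evenIx i₀) →
      g 1F (evenIx i₁) ∉π^ ℤ.suc s₁ → h (evenIx i₁) 1F ∉π^ ℤ.suc (- s₁) → ⊥
    even-even-absurd {k} {i₀} {i₁} {s₁} 1≤n b₀ g₁∉ h₁∉ =
      *-∉π^1 {s = s₁} g₁∉ h₁∉ (∈-weaken (≡.subst (1ℤ ℤ.≤_) (≡.sym loop) (1≤N 1≤n))
        (*-∈π^ (balanced-g′ b₀ (e-≤ (shape-g-pivot-even i₀ i₁))) (balanced-h b₀ (e-≤ (shape-h-pivot i₀ I₁)))))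
      where
      I₁ = evenIx i₁
      loop : (k ℤ.+ e 1F I₁) ℤ.+ (- k ℤ.+ e I₁ 1F) ≡ 1ℤ ℤ.* N
      loop = ≡.trans (+-neg-cancel k _ _) (≡.trans (e-sum 1F I₁ I₁ 1F) (≡.cong (ℤ._* N) (shape-even-loop i₁)))

    -- Passing through both pivots puts the row-1 pivot product g_{1I₁} h_{I₁1} in π^n O.
    odd-odd-absurd : ∀ {i₀ i₁ s₀ s₁} → 1 ℕ.≤ n →
      g 0F (oddIx i₀) ∉π^ ℤ.suc s₀ → h (oddIx i₀) 0F ∉π^ ℤ.suc (- s₀) →
      g 1F (oddIx i₁) ∈π^ s₁ → g 1F (oddIx i₁) ∉π^ ℤ.suc s₁ → h (oddIx i₁) 1F ∉π^ ℤ.suc (- s₁) → ⊥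
    odd-odd-absurd {i₀} {i₁} {s₀} {s₁} 1≤n g₀∉ h₀∉ g₁∈ g₁∉ h₁∉ =
      *-∉π^1 {s = s₁} g₁∉ h₁∉ (∈-weaken (≡.subst (1ℤ ℤ.≤_) (≡.sym loop) (1≤N 1≤n)) (*-∈π^ g₁∈ h₁∈))
      where
      I₀ = oddIx i₀
      I₁ = oddIx i₁
      X = (e 1F 0F - e I₁ I₀) - s₁
      h₀∈ : h I₀ 0F ∈π^ X
      h₀∈ = h-bound g₁∉ I₀ 0F
      s₀≤-X : s₀ ℤ.≤ - X
      s₀≤-X = ≡.subst (ℤ._≤ - X) (ℤ.neg-involutive s₀) (ℤ.neg-mono-≤ (∈-∉-≤ h₀∈ h₀∉))
      h₁∈ : h I₁ 1F ∈π^ ((e 0F 1F - e I₀ I₁) - - X)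
      h₁∈ = h-bound (∉-weaken (ℤ.suc-mono s₀≤-X) g₀∉) I₁ 1F
      loop : s₁ ℤ.+ ((e 0F 1F - e I₀ I₁) - - X) ≡ 1ℤ ℤ.* N
      loop = ≡.trans (+-sub-neg-sub-cancel s₁ (e 0F 1F - e I₀ I₁) (e 1F 0F - e I₁ I₀))
               (≡.trans (e-sum-diff 0F 1F I₀ I₁ 1F 0F I₁ I₀) (≡.cong (ℤ._* N) (shape-odd-loop i₀ i₁)))

    -- For n = 0 every exponent vanishes, so any pivot is balanced.
    zero-scaled : ∀ {I} → n ≡ 0 → (P : Pivot 0F I) → let s = Pivot.val P in
      (∀ j b → g j b ∈π^ (s ℤ.+ e j b)) × (∀ j b → h j b ∈π^ (- s ℤ.+ e j b))
    zero-scaled {I} n≡0 P@(pivot s _ _ _) =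
      (λ j b → balanced-g b₀ (zero-≤ j b I b 0F j I 0F)) , (λ j b → balanced-h b₀ (zero-≤ j b 0F b I j 0F I))
      where
      b₀ : Balanced s 0F I
      b₀ = pivot-balanced P (e-zero n≡0 0F I) (e-zero n≡0 I 0F)
      zero-≤ : ∀ x y u v w z p q → e x y ℤ.≤ (e u v - e w z) - e p q
      zero-≤ x y u v w z p q rewrite e-zero n≡0 x y | e-zero n≡0 u v | e-zero n≡0 w z | e-zero n≡0 p q = ℤ.≤-refl

  -- Multiplying by W⁻¹ on the left swaps rows 0 and 1 of g (up to π^-n), so the odd/even pivots become even/odd.
  module Swap {g h : Mat} (g∙h≈I : g ∙ h ≈M I) (h∙g≈I : h ∙ g ≈M I) (st-hg : Stable h g) (st-gh : Stable g h) where

    open import Algebra.Properties.Monoid monoid using (cancelᶜ)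

    G H : Mat
    G = W⁻¹ ∙ g
    H = h ∙ W

    G∙H≈I : G ∙ H ≈M I
    G∙H≈I = ≈M-trans (cancelᶜ g∙h≈I W⁻¹ W) W⁻¹∙W

    H∙G≈I : H ∙ G ≈M I
    H∙G≈I = ≈M-trans (cancelᶜ W∙W⁻¹ h g) h∙g≈I

    open Pivoting {g} {h} g∙h≈I st-hg st-gh public
    module Swapped = Pivoting G∙H≈I (Stable-∙ st-hg Stable-W-W⁻¹) (Stable-∙ Stable-W⁻¹-W st-gh)

    swap-pivot₁ : ∀ {I} → Pivot 1F I → Swapped.Pivot 0F I
    swap-pivot₁ {I} (pivot s g∈ g∉ h∉) = Swapped.pivot s (∈-resp-≈ (sym G₀) g∈) (∉-resp-≈ (sym G₀) g∉) (∉-resp-≈ (sym H₀) h∉)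
      where
      G₀ : G 0F I ≈ g 1F I
      G₀ = trans (∙-monomialˡ W⁻¹-monomial g 0F I) (*-identityˡ (g 1F I))
      H₀ : H I 0F ≈ h I 1F
      H₀ = trans (∙-monomialʳ σ-involutive W-monomial h I 0F) (*-identityʳ (h I 1F))

    swap-pivot₀ : ∀ {I} → Pivot 0F I → Swapped.Pivot 1F I
    swap-pivot₀ {I} (pivot s g∈ g∉ h∉) = Swapped.pivot (- N ℤ.+ s)
      (∈-resp-≈ (sym G₁) (*-∈π^ (π^∈π^ (- N)) g∈))
      (∉-scale {s = s} G₁ g∉)
      (≡.subst (λ t → H I 1F ∉π^ ℤ.suc t) (neg-distrib N s) (∉-scale {s = - s} H₁ h∉))
      where
      G₁ : G 1F I ≈ π^ (- N) * g 0F I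
      G₁ = ∙-monomialˡ W⁻¹-monomial g 1F I
      H₁ : H I 1F ≈ π^ N * h I 0F
      H₁ = trans (∙-monomialʳ σ-involutive W-monomial h I 1F) (*-comm (h I 0F) (π^ N))
      neg-distrib : ∀ a b → a ℤ.+ - b ≡ - (- a ℤ.+ b)
      neg-distrib = solve-∀

    g≈W∙G : g ≈M W ∙ G
    g≈W∙G = ≈M-sym (cancelˡ W∙W⁻¹ g)
      where open import Algebra.Properties.Monoid monoid using (cancelˡ)

  Stable⇒InUnion : ∀ {g h} → g ∙ h ≈M I → h ∙ g ≈M I → Stable h g → Stable g h → InUnion g
  Stable⇒InUnion {g} {h} g∙h≈I h∙g≈I st-hg st-gh =
    let I₀ , P₀ = pivot-exists 0F
        I₁ , P₁ = pivot-exists 1F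
    in [ (λ n≡0 → zero-case n≡0 P₀) , (λ 1≤n → positive-case 1≤n (parity I₀) (parity I₁) P₀ P₁) ]′ (zero⊎positive n)
    where
    open Swap g∙h≈I h∙g≈I st-hg st-gh

    even-balanced : ∀ {i₀} → (P : Pivot 0F (evenIx i₀)) → Balanced (Pivot.val P) 0F (evenIx i₀)
    even-balanced {i₀} P = pivot-balanced P (e≡0 (proj₁ (shape-even-row i₀))) (e≡0 (proj₂ (shape-even-row i₀)))

    zero-case : ∀ {I} → n ≡ 0 → Pivot 0F I → InUnion g
    zero-case n≡0 P =
      let g∈ , h∈ = zero-scaled n≡0 P in scaled-InUnion (Pivot.val P) false g∙h≈I h∙g≈I g∈ h∈ (≈M-sym (∙-identityˡ g))

    positive-case : ∀ {I₀ I₁} → 1 ℕ.≤ n → Parity I₀ → Parity I₁ → Pivot 0F I₀ → Pivot 1F I₁ → InUnion g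
    positive-case _ (even i₀) (odd i₁) P₀ (pivot s₁ _ g₁∉ h₁∉) =
      scaled-InUnion (Pivot.val P₀) false g∙h≈I h∙g≈I (g-scaled) (h-scaled) (≈M-sym (∙-identityˡ g))
      where open EvenOdd {s₁ = s₁} (even-balanced P₀) g₁∉ h₁∉
    positive-case 1≤n (even i₀) (even i₁) P₀ (pivot s₁ _ g₁∉ h₁∉) =
      ⊥-elim (even-even-absurd {s₁ = s₁} 1≤n (even-balanced P₀) g₁∉ h₁∉)
    positive-case 1≤n (odd i₀) (odd i₁) (pivot s₀ _ g₀∉ h₀∉) (pivot _ g₁∈ g₁∉ h₁∉) =
      ⊥-elim (odd-odd-absurd {s₀ = s₀} 1≤n g₀∉ h₀∉ g₁∈ g₁∉ h₁∉)
    positive-case _ (odd i₀) (even i₁) P₀ P₁ =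
      scaled-InUnion (Pivot.val P₁) true G∙H≈I H∙G≈I g-scaled h-scaled g≈W∙G
      where
      P₀′ = swap-pivot₁ P₁
      P₁′ = swap-pivot₀ P₀
      b₀ = Swapped.pivot-balanced P₀′ (e≡0 (proj₁ (shape-even-row i₁))) (e≡0 (proj₂ (shape-even-row i₁)))
      open Swapped.EvenOdd {s₁ = Swapped.Pivot.val P₁′} b₀ (Swapped.Pivot.g∉ P₁′) (Swapped.Pivot.h∉ P₁′)

  normaliser : ∀ {g h} → g ∙ h ≈M I → h ∙ g ≈M I → Normalises g h ⇔ InUnion g
  normaliser g∙h≈I h∙g≈I = mk⇔
    (λ normalises → uncurry (Stable⇒InUnion g∙h≈I h∙g≈I) (Equivalence.to (normalises⇔stable g∙h≈I h∙g≈I) normalises))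
    (λ g∈ → Equivalence.from (normalises⇔stable g∙h≈I h∙g≈I) (InUnion⇒Stable h∙g≈I g∈))

-- The field ℚ_p of Defs

open Defs

module PrimePowers {p : ℕ} (p-prime : Prime p) where

  private
    instance
      p≢0 : ℕ.NonZero p
      p≢0 = prime⇒nonZero p-prime

  coprime-power-cancel : ∀ γ x y → ¬ p ℕ∣ x → p ℕ.^ γ ℕ∣ x ℕ.* y → p ℕ.^ γ ℕ∣ y
  coprime-power-cancel zero x y _ _ = ℕ∣.1∣ y
  coprime-power-cancel (suc γ) x y p∤x p^γ⁺∣xy with euclidsLemma x y p-prime (ℕ∣.∣-trans (ℕ∣.m∣m*n (p ℕ.^ γ)) p^γ⁺∣xy)
  ... | inj₁ p∣x = ⊥-elim (p∤x p∣x)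
  ... | inj₂ (ℕ∣.divides q ≡.refl) =
    ≡.subst (p ℕ.^ suc γ ℕ∣_) (ℕ.*-comm p q) (ℕ∣.*-monoʳ-∣ p (coprime-power-cancel γ x q p∤x (ℕ∣.*-cancelˡ-∣ p p^γ⁺∣pxq)))
    where
    p^γ⁺∣pxq : p ℕ.* p ℕ.^ γ ℕ∣ p ℕ.* (x ℕ.* q)
    p^γ⁺∣pxq = ≡.subst (p ℕ.^ suc γ ℕ∣_) (rearrange x q p) p^γ⁺∣xy
      where
      rearrange : ∀ x q p → x ℕ.* (q ℕ.* p) ≡ p ℕ.* (x ℕ.* q)
      rearrange = ℕ-solve-∀

  power-cancel : ∀ μ γ x y → ¬ p ℕ.^ suc μ ℕ∣ x → p ℕ.^ (μ ℕ.+ γ) ℕ∣ x ℕ.* y → p ℕ.^ γ ℕ∣ y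
  power-cancel zero γ x y p∤x = coprime-power-cancel γ x y (λ p∣x → p∤x (≡.subst (ℕ∣._∣ x) (≡.sym (ℕ.*-identityʳ p)) p∣x))
  power-cancel (suc μ) γ x y p^μ⁺∤x p^μγ∣xy with p ℕ∣? x
  ... | no p∤x = ℕ∣.∣-trans (ℕ∣.n∣m*n (p ℕ.^ suc μ))
                   (≡.subst (ℕ∣._∣ y) (ℕ.^-distribˡ-+-* p (suc μ) γ) (coprime-power-cancel (suc μ ℕ.+ γ) x y p∤x p^μγ∣xy))
  ... | yes (ℕ∣.divides q ≡.refl) =
    power-cancel μ γ q y p^μ∤q (ℕ∣.*-cancelˡ-∣ p (≡.subst (p ℕ.^ suc (μ ℕ.+ γ) ℕ∣_) (rearrange q p y) p^μγ∣xy))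
    where
    rearrange : ∀ q p y → q ℕ.* p ℕ.* y ≡ p ℕ.* (q ℕ.* y)
    rearrange = ℕ-solve-∀
    p^μ∤q : ¬ p ℕ.^ suc μ ℕ∣ q
    p^μ∤q p^μ∣q = p^μ⁺∤x (≡.subst (ℕ∣._∣ q ℕ.* p) (ℕ.*-comm (p ℕ.^ suc μ) p) (ℕ∣.*-monoˡ-∣ p p^μ∣q))

module PAdicIntegers (p : ℕ) .{{_ : ℕ.NonZero p}} where

  open import Data.Integer.Base using (_+_; _*_)

  p^ : ℕ → ℤ
  p^ = P^ p

  p^-+ : ∀ a b → p^ (a ℕ.+ b) ≡ p^ a * p^ b
  p^-+ a b = ≡.trans (≡.cong +_ (ℕ.^-distribˡ-+-* p a b)) (ℤ.pos-* (p ℕ.^ a) (p ℕ.^ b))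

  p^-nonZero : ∀ k → ℤ.NonZero (p^ k)
  p^-nonZero k = ℕ.m^n≢0 p k

  p^-mono-∣ : ∀ {m n} → m ℕ.≤ n → p^ m ∣ p^ n
  p^-mono-∣ {m} {n} m≤n =
    ≡.subst (p^ m ∣_) (≡.trans (≡.sym (p^-+ m (n ℕ.∸ m))) (≡.cong p^ (ℕ.m+[n∸m]≡n m≤n))) (∣m⇒∣m*n (p^ (n ℕ.∸ m)) ∣-refl)

  infix 4 _≋_mod_
  _≋_mod_ : ℤ → ℤ → ℤ → Set
  x ≋ y mod k = k ∣ x - y

  mod-reflexive : ∀ {k x y} → x ≡ y → x ≋ y mod k
  mod-reflexive {k} {x} ≡.refl = divides (+ 0) (≡.trans (ℤ.+-inverseʳ x) (≡.sym (ℤ.*-zeroˡ k)))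

  mod-sym : ∀ {k x y} → x ≋ y mod k → y ≋ x mod k
  mod-sym {k} {x} {y} x≡y = ≡.subst (k ∣_) (neg-sub x y) (∣m⇒∣-m x≡y)
    where
    neg-sub : ∀ x y → - (x - y) ≡ y - x
    neg-sub = solve-∀

  mod-trans : ∀ {k x y z} → x ≋ y mod k → y ≋ z mod k → x ≋ z mod k
  mod-trans {k} {x} {y} {z} x≡y y≡z = ≡.subst (k ∣_) (sub-sub x y z) (∣m∣n⇒∣m+n x≡y y≡z)
    where
    sub-sub : ∀ x y z → (x - y) + (y - z) ≡ x - z
    sub-sub = solve-∀

  coherent-≤ : ∀ (a : ℤp p) {m K} → m ℕ.≤ K → seq a K ≋ seq a m mod p^ m
  coherent-≤ a {m} {K} m≤K = ≡.subst (λ z → seq a z ≋ seq a m mod p^ m) (ℕ.m∸n+n≡m m≤K) (go (K ℕ.∸ m))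
    where
    go : ∀ j → seq a (j ℕ.+ m) ≋ seq a m mod p^ m
    go zero = mod-reflexive {x = seq a m} ≡.refl
    go (suc j) = mod-trans {x = seq a (suc j ℕ.+ m)} {y = seq a (j ℕ.+ m)} (∣-trans (p^-mono-∣ (ℕ.m≤n+m m j)) (coh a (j ℕ.+ m))) (go j)

  -ℤp_ : ℤp p → ℤp p
  -ℤp a = mkℤp (λ k → - seq a k) (λ k → ≡.subst (p^ k ∣_) (neg-sub (seq a (suc k)) (seq a k)) (∣m⇒∣-m (coh a k)))
    where
    neg-sub : ∀ x y → - (x - y) ≡ - x - - y
    neg-sub = solve-∀

  p^-torsion-free : ∀ (a : ℤp p) d → (∀ k → p^ k ∣ p^ d * seq a k) → ∀ k → p^ k ∣ seq a k
  p^-torsion-free a d p^d·a≡0 k =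
    ≡.subst (p^ k ∣_) (sub-sub (seq a (k ℕ.+ d)) (seq a k)) (∣m∣n⇒∣m-n p^k∣a[k+d] (coherent-≤ a (ℕ.m≤m+n k d)))
    where
    sub-sub : ∀ x y → x - (x - y) ≡ y
    sub-sub = solve-∀
    p^k∣a[k+d] : p^ k ∣ seq a (k ℕ.+ d)
    p^k∣a[k+d] = *-cancelˡ-∣ (p^ d) {{p^-nonZero d}}
      (≡.subst (_∣ p^ d * seq a (k ℕ.+ d)) (≡.trans (≡.cong p^ (ℕ.+-comm k d)) (p^-+ d k)) (p^d·a≡0 (k ℕ.+ d)))

  private
    infixl 6 _+ₚ_
    infixl 7 _*ₚ_
    _+ₚ_ = _+ℤp_ p
    _*ₚ_ = _*ℤp_ p
    const = constℤp p

  -- The field operations of ℚ_p are made opaque, so that their arguments can be inferred;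
  -- unfolded, they are exactly those of Defs.
  infix 4 _≃_
  infixl 6 _⊕_
  infixl 7 _⊗_
  opaque
    _≃_ : ℚp p → ℚp p → Set
    _≃_ = _≈_ p
    _⊕_ _⊗_ : ℚp p → ℚp p → ℚp p
    _⊕_ = _+Q_ p
    _⊗_ = _*Q_ p
    -Q_ : ℚp p → ℚp p
    -Q x = (-ℤp num x) /p^ den x

  opaque
    unfolding _≃_ _⊕_ _⊗_ -Q_


    ≃-of-≡ : ∀ {x y} → (∀ k → p^ (den y) * seq (num x) k ≡ p^ (den x) * seq (num y) k) → x ≃ y
    ≃-of-≡ {x} {y} eq k = mod-reflexive {x = p^ (den y) * seq (num x) k} (eq k)

    ≃-refl : ∀ {x} → x ≃ x
    ≃-refl {x} = ≃-of-≡ {x} {x} λ _ → ≡.refl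

    ≃-sym : ∀ {x y} → x ≃ y → y ≃ x
    ≃-sym {x} {y} x≃y k = mod-sym {x = p^ (den y) * seq (num x) k} {y = p^ (den x) * seq (num y) k} (x≃y k)

    ≃-trans : ∀ {x y z} → x ≃ y → y ≃ z → x ≃ z
    ≃-trans {x} {y} {z} x≃y y≃z = p^-torsion-free T (den y) λ k →
      ≡.subst (p^ k ∣_) (combine (p^ (den x)) (p^ (den y)) (p^ (den z)) (seq (num x) k) (seq (num y) k) (seq (num z) k))
        (∣m∣n⇒∣m+n (∣n⇒∣m*n (p^ (den z)) (x≃y k)) (∣n⇒∣m*n (p^ (den x)) (y≃z k)))
      where
      T : ℤp p
      T = (const (p^ (den z)) *ₚ num x) +ₚ (-ℤp (const (p^ (den x)) *ₚ num z))
      combine : ∀ A B C X Y Z → C * (B * X - A * Y) + A * (C * Y - B * Z) ≡ B * (C * X + - (A * Z))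
      combine = solve-∀

    -- The field laws below reduce, after expanding p^(a + b) = p^a p^b, to polynomial identities over ℤ.
    private
      +-cong-identity : ∀ A B A′ B′ X Y X′ Y′ →
        (A′ * B′) * (B * X + A * Y) - (A * B) * (B′ * X′ + A′ * Y′) ≡ (B′ * B) * (A′ * X - A * X′) + (A′ * A) * (B′ * Y - B * Y′)
      +-cong-identity = solve-∀
      *-cong-identity : ∀ A B A′ B′ X Y X′ Y′ →
        (A′ * B′) * (X * Y) - (A * B) * (X′ * Y′) ≡ (B′ * Y) * (A′ * X - A * X′) + (A * X′) * (B′ * Y - B * Y′)
      *-cong-identity = solve-∀
      neg-cong-identity : ∀ A A′ X X′ → A′ * (- X) - A * (- X′) ≡ - (A′ * X - A * X′)
      neg-cong-identity = solve-∀
      +-assoc-identity : ∀ A B C X Y Z →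
        (A * (B * C)) * (C * (B * X + A * Y) + (A * B) * Z) ≡ ((A * B) * C) * ((B * C) * X + A * (C * Y + B * Z))
      +-assoc-identity = solve-∀
      +-identityˡ-identity : ∀ A X → A * (A * + 0 + + 1 * X) ≡ A * X
      +-identityˡ-identity = solve-∀
      +-identityʳ-identity : ∀ A X → A * (+ 1 * X + A * + 0) ≡ A * X
      +-identityʳ-identity = solve-∀
      +-inverseˡ-identity : ∀ A B X → + 1 * (A * - X + A * X) ≡ B * + 0
      +-inverseˡ-identity = solve-∀
      distribˡ-identity : ∀ A B C X Y Z →
        ((A * B) * (A * C)) * (X * (C * Y + B * Z)) ≡ (A * (B * C)) * ((A * C) * (X * Y) + (A * B) * (X * Z))
      distribˡ-identity = solve-∀
      distribʳ-identity : ∀ A B C X Y Z →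
        ((B * A) * (C * A)) * ((C * Y + B * Z) * X) ≡ ((B * C) * A) * ((C * A) * (Y * X) + (B * A) * (Z * X))
      distribʳ-identity = solve-∀

    ⊕-cong : ∀ {x x′ y y′} → x ≃ x′ → y ≃ y′ → x ⊕ y ≃ x′ ⊕ y′
    ⊕-cong {x} {x′} {y} {y′} x≃x′ y≃y′ k = ≡.subst (p^ k ∣_) (≡.sym expand)
      (∣m∣n⇒∣m+n (∣n⇒∣m*n (p^ (den y′) * p^ (den y)) (x≃x′ k)) (∣n⇒∣m*n (p^ (den x′) * p^ (den x)) (y≃y′ k)))
      where
      expand : p^ (den x′ ℕ.+ den y′) * seq (num (x ⊕ y)) k - p^ (den x ℕ.+ den y) * seq (num (x′ ⊕ y′)) k ≡
               (p^ (den y′) * p^ (den y)) * (p^ (den x′) * seq (num x) k - p^ (den x) * seq (num x′) k) +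
               (p^ (den x′) * p^ (den x)) * (p^ (den y′) * seq (num y) k - p^ (den y) * seq (num y′) k)
      expand = ≡.trans
        (≡.cong₂ (λ u v → u * seq (num (x ⊕ y)) k - v * seq (num (x′ ⊕ y′)) k) (p^-+ (den x′) (den y′)) (p^-+ (den x) (den y)))
        (+-cong-identity (p^ (den x)) (p^ (den y)) (p^ (den x′)) (p^ (den y′)) (seq (num x) k) (seq (num y) k) (seq (num x′) k) (seq (num y′) k))

    ⊗-cong : ∀ {x x′ y y′} → x ≃ x′ → y ≃ y′ → x ⊗ y ≃ x′ ⊗ y′
    ⊗-cong {x} {x′} {y} {y′} x≃x′ y≃y′ k = ≡.subst (p^ k ∣_) (≡.sym expand)
      (∣m∣n⇒∣m+n (∣n⇒∣m*n (p^ (den y′) * seq (num y) k) (x≃x′ k)) (∣n⇒∣m*n (p^ (den x) * seq (num x′) k) (y≃y′ k)))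
      where
      expand : p^ (den x′ ℕ.+ den y′) * seq (num (x ⊗ y)) k - p^ (den x ℕ.+ den y) * seq (num (x′ ⊗ y′)) k ≡
               (p^ (den y′) * seq (num y) k) * (p^ (den x′) * seq (num x) k - p^ (den x) * seq (num x′) k) +
               (p^ (den x) * seq (num x′) k) * (p^ (den y′) * seq (num y) k - p^ (den y) * seq (num y′) k)
      expand = ≡.trans
        (≡.cong₂ (λ u v → u * seq (num (x ⊗ y)) k - v * seq (num (x′ ⊗ y′)) k) (p^-+ (den x′) (den y′)) (p^-+ (den x) (den y)))
        (*-cong-identity (p^ (den x)) (p^ (den y)) (p^ (den x′)) (p^ (den y′)) (seq (num x) k) (seq (num y) k) (seq (num x′) k) (seq (num y′) k))

    -Q-cong : ∀ {x x′} → x ≃ x′ → -Q x ≃ -Q x′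
    -Q-cong {x} {x′} x≃x′ k =
      ≡.subst (p^ k ∣_) (≡.sym (neg-cong-identity (p^ (den x)) (p^ (den x′)) (seq (num x) k) (seq (num x′) k))) (∣m⇒∣-m (x≃x′ k))

    p^-+₃ : ∀ a b c → p^ (a ℕ.+ (b ℕ.+ c)) ≡ p^ a * (p^ b * p^ c)
    p^-+₃ a b c = ≡.trans (p^-+ a (b ℕ.+ c)) (≡.cong (p^ a *_) (p^-+ b c))

    p^-+₃′ : ∀ a b c → p^ ((a ℕ.+ b) ℕ.+ c) ≡ (p^ a * p^ b) * p^ c
    p^-+₃′ a b c = ≡.trans (p^-+ (a ℕ.+ b) c) (≡.cong (_* p^ c) (p^-+ a b))

    ⊕-comm : ∀ x y → x ⊕ y ≃ y ⊕ x
    ⊕-comm x y = ≃-of-≡ {x ⊕ y} {y ⊕ x} λ k →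
      ≡.cong₂ _*_ (≡.cong p^ (ℕ.+-comm (den y) (den x))) (ℤ.+-comm (p^ (den y) * seq (num x) k) (p^ (den x) * seq (num y) k))

    ⊕-assoc : ∀ x y z → (x ⊕ y) ⊕ z ≃ x ⊕ (y ⊕ z)
    ⊕-assoc x y z = ≃-of-≡ {(x ⊕ y) ⊕ z} {x ⊕ (y ⊕ z)} λ k → let X = seq (num x) k; Y = seq (num y) k; Z = seq (num z) k in
      ≡.trans (≡.cong₂ (λ u v → u * (p^ (den z) * (p^ (den y) * X + p^ (den x) * Y) + v * Z)) (p^-+₃ (den x) (den y) (den z)) (p^-+ (den x) (den y)))
        (≡.trans (+-assoc-identity (p^ (den x)) (p^ (den y)) (p^ (den z)) X Y Z)
          (≡.sym (≡.cong₂ (λ u v → u * (v * X + p^ (den x) * (p^ (den z) * Y + p^ (den y) * Z)))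
                          (p^-+₃′ (den x) (den y) (den z)) (p^-+ (den y) (den z)))))

    ⊕-identityˡ : ∀ x → 0Q p ⊕ x ≃ x
    ⊕-identityˡ x = ≃-of-≡ {0Q p ⊕ x} {x} λ k → +-identityˡ-identity (p^ (den x)) (seq (num x) k)

    ⊕-identityʳ : ∀ x → x ⊕ 0Q p ≃ x
    ⊕-identityʳ x = ≃-of-≡ {x ⊕ 0Q p} {x} λ k →
      ≡.trans (+-identityʳ-identity (p^ (den x)) (seq (num x) k)) (≡.cong (λ d → p^ d * seq (num x) k) (≡.sym (ℕ.+-identityʳ (den x))))

    ⊕-inverseˡ : ∀ x → -Q x ⊕ x ≃ 0Q p
    ⊕-inverseˡ x = ≃-of-≡ { -Q x ⊕ x} {0Q p} λ k → +-inverseˡ-identity (p^ (den x)) (p^ (den x ℕ.+ den x)) (seq (num x) k)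

    ⊕-inverseʳ : ∀ x → x ⊕ -Q x ≃ 0Q p
    ⊕-inverseʳ x = ≃-trans {x ⊕ -Q x} { -Q x ⊕ x} {0Q p} (⊕-comm x (-Q x)) (⊕-inverseˡ x)

    ⊗-assoc : ∀ x y z → (x ⊗ y) ⊗ z ≃ x ⊗ (y ⊗ z)
    ⊗-assoc x y z = ≃-of-≡ {(x ⊗ y) ⊗ z} {x ⊗ (y ⊗ z)} λ k →
      ≡.cong₂ _*_ (≡.cong p^ (≡.sym (ℕ.+-assoc (den x) (den y) (den z)))) (ℤ.*-assoc (seq (num x) k) (seq (num y) k) (seq (num z) k))

    ⊗-identityˡ : ∀ x → 1Q p ⊗ x ≃ x
    ⊗-identityˡ x = ≃-of-≡ {1Q p ⊗ x} {x} λ k → ≡.cong (p^ (den x) *_) (ℤ.*-identityˡ (seq (num x) k))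

    ⊗-identityʳ : ∀ x → x ⊗ 1Q p ≃ x
    ⊗-identityʳ x = ≃-of-≡ {x ⊗ 1Q p} {x} λ k →
      ≡.cong₂ _*_ (≡.cong p^ (≡.sym (ℕ.+-identityʳ (den x)))) (ℤ.*-identityʳ (seq (num x) k))

    ⊗-comm : ∀ x y → x ⊗ y ≃ y ⊗ x
    ⊗-comm x y = ≃-of-≡ {x ⊗ y} {y ⊗ x} λ k →
      ≡.cong₂ _*_ (≡.cong p^ (ℕ.+-comm (den y) (den x))) (ℤ.*-comm (seq (num x) k) (seq (num y) k))

    ⊗-distribˡ-⊕ : ∀ x y z → x ⊗ (y ⊕ z) ≃ (x ⊗ y) ⊕ (x ⊗ z)
    ⊗-distribˡ-⊕ x y z = ≃-of-≡ {x ⊗ (y ⊕ z)} {(x ⊗ y) ⊕ (x ⊗ z)} λ k →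
      let X = seq (num x) k; Y = seq (num y) k; Z = seq (num z) k; dx = den x; dy = den y; dz = den z in
      ≡.trans (≡.cong (λ u → u * (X * (p^ dz * Y + p^ dy * Z)))
                      (≡.trans (p^-+ (dx ℕ.+ dy) (dx ℕ.+ dz)) (≡.cong₂ _*_ (p^-+ dx dy) (p^-+ dx dz))))
        (≡.trans (distribˡ-identity (p^ dx) (p^ dy) (p^ dz) X Y Z)
          (≡.sym (≡.cong₂ (λ u v → u * v) (p^-+₃ dx dy dz) (≡.cong₂ (λ v w → v * (X * Y) + w * (X * Z)) (p^-+ dx dz) (p^-+ dx dy)))))

    ⊗-distribʳ-⊕ : ∀ x y z → (y ⊕ z) ⊗ x ≃ (y ⊗ x) ⊕ (z ⊗ x)
    ⊗-distribʳ-⊕ x y z = ≃-of-≡ {(y ⊕ z) ⊗ x} {(y ⊗ x) ⊕ (z ⊗ x)} λ k →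
      let X = seq (num x) k; Y = seq (num y) k; Z = seq (num z) k; dx = den x; dy = den y; dz = den z in
      ≡.trans (≡.cong (λ u → u * ((p^ dz * Y + p^ dy * Z) * X))
                      (≡.trans (p^-+ (dy ℕ.+ dx) (dz ℕ.+ dx)) (≡.cong₂ _*_ (p^-+ dy dx) (p^-+ dz dx))))
        (≡.trans (distribʳ-identity (p^ dx) (p^ dy) (p^ dz) X Y Z)
          (≡.sym (≡.cong₂ (λ u v → u * v) (p^-+₃′ dy dz dx) (≡.cong₂ (λ v w → v * (Y * X) + w * (Z * X)) (p^-+ dz dx) (p^-+ dy dx)))))

  ℚp-ring : CommutativeRing 0ℓ 0ℓ
  ℚp-ring = record
    { Carrier = ℚp p ; _≈_ = _≃_ ; _+_ = _⊕_ ; _*_ = _⊗_ ; -_ = -Q_ ; 0# = 0Q p ; 1# = 1Q p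
    ; isCommutativeRing = record
      { isRing = record
        { +-isAbelianGroup = record
          { isGroup = record
            { isMonoid = record
              { isSemigroup = record
                { isMagma = record
                  { isEquivalence = record
                    { refl = λ {x} → ≃-refl {x} ; sym = λ {x} {y} → ≃-sym {x} {y} ; trans = λ {x} {y} {z} → ≃-trans {x} {y} {z} }
                  ; ∙-cong = λ {x} {x′} {y} {y′} → ⊕-cong {x} {x′} {y} {y′}
                  }
                ; assoc = ⊕-assoc
                }
              ; identity = ⊕-identityˡ , ⊕-identityʳ
              }
            ; inverse = ⊕-inverseˡ , ⊕-inverseʳ
            ; ⁻¹-cong = λ {x} {x′} → -Q-cong {x} {x′}
            }
          ; comm = ⊕-comm
          }
        ; *-cong = λ {x} {x′} {y} {y′} → ⊗-cong {x} {x′} {y} {y′}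
        ; *-assoc = ⊗-assoc
        ; *-identity = ⊗-identityˡ , ⊗-identityʳ
        ; distrib = ⊗-distribˡ-⊕ , ⊗-distribʳ-⊕
        }
      ; *-comm = ⊗-comm
      }
    }

  ratio : ℕ → ℕ → ℚp p
  ratio m j = const (p^ m) /p^ j

  pos-part neg-part : ℤ → ℕ
  pos-part (+ m) = m
  pos-part -[1+ _ ] = 0
  neg-part (+ _) = 0
  neg-part -[1+ j ] = suc j

  pos-part-neg-part : ∀ t → + pos-part t - + neg-part t ≡ t
  pos-part-neg-part (+ m) = ℤ.+-identityʳ (+ m)
  pos-part-neg-part -[1+ j ] = ≡.refl

  pow≡ratio : ∀ t → pow p t ≡ ratio (pos-part t) (neg-part t)
  pow≡ratio (+ m) = ≡.refl
  pow≡ratio -[1+ j ] = ≡.refl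

  opaque
    unfolding _≃_ _⊕_ _⊗_

    ratio-⊗ : ∀ m j m′ j′ → (ratio m j) ⊗ (ratio m′ j′) ≃ ratio (m ℕ.+ m′) (j ℕ.+ j′)
    ratio-⊗ m j m′ j′ = ≃-of-≡ {(ratio m j) ⊗ (ratio m′ j′)} {ratio (m ℕ.+ m′) (j ℕ.+ j′)} λ _ →
      ≡.cong (p^ (j ℕ.+ j′) *_) (≡.sym (p^-+ m m′))

    ratio-cong : ∀ m j m′ j′ → m ℕ.+ j′ ≡ m′ ℕ.+ j → ratio m j ≃ ratio m′ j′
    ratio-cong m j m′ j′ eq = ≃-of-≡ {ratio m j} {ratio m′ j′} λ _ →
      ≡.trans (≡.sym (p^-+ j′ m)) (≡.trans (≡.cong p^ (≡.trans (ℕ.+-comm j′ m) (≡.trans eq (ℕ.+-comm m′ j)))) (p^-+ j m′))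

    ι-⊕ : ∀ a b → ι p a ⊕ ι p b ≃ ι p (a +ₚ b)
    ι-⊕ a b = ≃-of-≡ {ι p a ⊕ ι p b} {ι p (a +ₚ b)} λ k → identity (seq a k) (seq b k)
      where
      identity : ∀ x y → + 1 * (+ 1 * x + + 1 * y) ≡ + 1 * (x + y)
      identity = solve-∀

    ι-⊗ : ∀ a b → ι p a ⊗ ι p b ≃ ι p (a *ₚ b)
    ι-⊗ a b = ≃-refl {ι p (a *ₚ b)}

    p^-⊗-ι : ∀ m a → pow p (+ m) ⊗ ι p a ≃ ι p (const (p^ m) *ₚ a)
    p^-⊗-ι m a = ≃-refl {ι p (const (p^ m) *ₚ a)}

    pow-≡-cong : ∀ {s t} → s ≡ t → pow p s ≃ pow p t
    pow-≡-cong {s} ≡.refl = ≃-refl {pow p s}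

  open CommutativeRing ℚp-ring using (+-cong; *-identityʳ; *-assoc; *-cong; *-congˡ; *-congʳ; distribˡ; zeroʳ; *-commutativeSemigroup)

  private
    pos-diff-injective : ∀ a b c d → + a - + b ≡ + c - + d → a ℕ.+ d ≡ c ℕ.+ b
    pos-diff-injective a b c d eq = ℤ.+-injective (≡.trans (ℤ.pos-+ a d) (≡.trans (shuffle (+ a) (+ b) (+ d))
      (≡.trans (≡.cong (_+ (+ b + + d)) eq) (≡.trans (unshuffle (+ b) (+ c) (+ d)) (≡.sym (ℤ.pos-+ c b))))))
      where
      shuffle : ∀ a b d → a + d ≡ (a - b) + (b + d)
      shuffle = solve-∀
      unshuffle : ∀ b c d → (c - d) + (b + d) ≡ c + b
      unshuffle = solve-∀

    split-+ : ∀ s t → + (pos-part s ℕ.+ pos-part t) - + (neg-part s ℕ.+ neg-part t) ≡ + pos-part (s + t) - + neg-part (s + t)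
    split-+ s t = ≡.trans (≡.cong₂ _-_ (ℤ.pos-+ (pos-part s) (pos-part t)) (ℤ.pos-+ (neg-part s) (neg-part t)))
      (≡.trans (regroup (+ pos-part s) (+ pos-part t) (+ neg-part s) (+ neg-part t))
        (≡.trans (≡.cong₂ _+_ (pos-part-neg-part s) (pos-part-neg-part t)) (≡.sym (pos-part-neg-part (s + t)))))
      where
      regroup : ∀ a b c d → (a + b) - (c + d) ≡ (a - c) + (b - d)
      regroup = solve-∀

  private module ≃-Reasoning = Relation.Binary.Reasoning.Setoid (CommutativeRing.setoid ℚp-ring)

  pow-+ : ∀ s t → pow p s ⊗ pow p t ≃ pow p (s + t)
  pow-+ s t = begin
    pow p s ⊗ pow p t            ≡⟨ ≡.cong₂ _⊗_ (pow≡ratio s) (pow≡ratio t) ⟩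
    ratio m j ⊗ ratio m′ j′      ≈⟨ ratio-⊗ m j m′ j′ ⟩
    ratio (m ℕ.+ m′) (j ℕ.+ j′)  ≈⟨ ratio-cong (m ℕ.+ m′) (j ℕ.+ j′) m″ j″
                                      (pos-diff-injective (m ℕ.+ m′) (j ℕ.+ j′) m″ j″ (split-+ s t)) ⟩
    ratio m″ j″                  ≡⟨ ≡.sym (pow≡ratio (s + t)) ⟩
    pow p (s + t)                ∎
    where
    open ≃-Reasoning
    m = pos-part s
    j = neg-part s
    m′ = pos-part t
    j′ = neg-part t
    m″ = pos-part (s + t)
    j″ = neg-part (s + t)

  infix 4 _∈π^_
  _∈π^_ : ℚp p → ℤ → Set
  x ∈π^ t = ∃ λ a → x ≃ pow p t ⊗ ι p a

  ∈-resp-≃ : ∀ {x y t} → x ≃ y → x ∈π^ t → y ∈π^ t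
  ∈-resp-≃ x≃y (a , x≃) = a , ≃-trans (≃-sym x≃y) x≃

  *-∈π^ : ∀ {x y s t} → x ∈π^ s → y ∈π^ t → x ⊗ y ∈π^ (s + t)
  *-∈π^ {x} {y} {s} {t} (a , x≃) (b , y≃) = a *ₚ b , chain
    where
    open ≃-Reasoning
    open import Algebra.Properties.CommutativeSemigroup *-commutativeSemigroup using (interchange)
    chain : x ⊗ y ≃ pow p (s + t) ⊗ ι p (a *ₚ b)
    chain = begin
      x ⊗ y                                  ≈⟨ *-cong x≃ y≃ ⟩
      (pow p s ⊗ ι p a) ⊗ (pow p t ⊗ ι p b)  ≈⟨ interchange (pow p s) (ι p a) (pow p t) (ι p b) ⟩
      (pow p s ⊗ pow p t) ⊗ (ι p a ⊗ ι p b)  ≈⟨ *-cong (pow-+ s t) (ι-⊗ a b) ⟩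
      pow p (s + t) ⊗ ι p (a *ₚ b)           ∎

  +-∈π^ : ∀ {x y t} → x ∈π^ t → y ∈π^ t → x ⊕ y ∈π^ t
  +-∈π^ {x} {y} {t} (a , x≃) (b , y≃) = a +ₚ b , chain
    where
    open ≃-Reasoning
    chain : x ⊕ y ≃ pow p t ⊗ ι p (a +ₚ b)
    chain = begin
      x ⊕ y                              ≈⟨ +-cong x≃ y≃ ⟩
      pow p t ⊗ ι p a ⊕ pow p t ⊗ ι p b  ≈⟨ ≃-sym (distribˡ (pow p t) (ι p a) (ι p b)) ⟩
      pow p t ⊗ (ι p a ⊕ ι p b)          ≈⟨ *-congˡ (ι-⊕ a b) ⟩
      pow p t ⊗ ι p (a +ₚ b)             ∎

  ∈-weaken : ∀ {x s t} → t ℤ.≤ s → x ∈π^ s → x ∈π^ t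
  ∈-weaken {x} {s} {t} t≤s (a , x≃) = const (p^ m) *ₚ a , chain
    where
    open ≃-Reasoning
    m = ℤ.∣ s - t ∣
    s≡t+m : s ≡ t + + m
    s≡t+m = ≡.trans (add-sub s t) (≡.cong (_+_ t) (≡.sym (ℤ.0≤i⇒+∣i∣≡i (ℤ.i≤j⇒0≤j-i t≤s))))
      where
      add-sub : ∀ s t → s ≡ t + (s - t)
      add-sub = solve-∀
    chain : x ≃ pow p t ⊗ ι p (const (p^ m) *ₚ a)
    chain = begin
      x                                   ≈⟨ x≃ ⟩
      pow p s ⊗ ι p a                     ≈⟨ *-congʳ (pow-≡-cong s≡t+m) ⟩
      pow p (t + + m) ⊗ ι p a             ≈⟨ *-congʳ (≃-sym (pow-+ t (+ m))) ⟩
      (pow p t ⊗ pow p (+ m)) ⊗ ι p a     ≈⟨ *-assoc (pow p t) (pow p (+ m)) (ι p a) ⟩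
      pow p t ⊗ (pow p (+ m) ⊗ ι p a)     ≈⟨ *-congˡ (p^-⊗-ι m a) ⟩
      pow p t ⊗ ι p (const (p^ m) *ₚ a)   ∎

  0∈π^ : ∀ t → 0Q p ∈π^ t
  0∈π^ t = const (+ 0) , ≃-sym (zeroʳ (pow p t))

  π^∈π^ : ∀ t → pow p t ∈π^ t
  π^∈π^ t = const (+ 1) , ≃-sym (*-identityʳ (pow p t))

  -- k ∣ᵖ a says a ∈ p^k ℤ_p; by coherence this is divisibility of the k-th approximation alone.
  infix 4 _∣ᵖ_
  _∣ᵖ_ : ℕ → ℤp p → Set
  E ∣ᵖ a = p^ E ∣ seq a E

  ∣ᵖ-zero : ∀ a → 0 ∣ᵖ a
  ∣ᵖ-zero a = divides (seq a 0) (≡.sym (ℤ.*-identityʳ (seq a 0)))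

  ∣ᵖ-shift : ∀ {E a} → E ∣ᵖ a → ∀ k → p^ E ∣ seq a (k ℕ.+ E)
  ∣ᵖ-shift {E} {a} E∣a k = ≡.subst (p^ E ∣_) (sub-add (seq a (k ℕ.+ E)) (seq a E)) (∣m∣n⇒∣m+n (coherent-≤ a (ℕ.m≤n+m E k)) E∣a)
    where
    sub-add : ∀ x y → (x - y) + y ≡ x
    sub-add = solve-∀

  ∣ᵖ-of : ∀ {E K a} → p^ E ∣ seq a K → E ℕ.≤ K → E ∣ᵖ a
  ∣ᵖ-of {E} {K} {a} p^E∣aK E≤K = ≡.subst (p^ E ∣_) (sub-sub (seq a K) (seq a E)) (∣m∣n⇒∣m-n p^E∣aK (coherent-≤ a E≤K))
    where
    sub-sub : ∀ x y → x - (x - y) ≡ y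
    sub-sub = solve-∀

  pos-part-⊖ : ∀ a b → pos-part (a ℤ.⊖ b) ≡ a ℕ.∸ b
  pos-part-⊖ a b with b ℕ.≤? a
  ... | yes b≤a = ≡.cong pos-part (ℤ.⊖-≥ b≤a)
  ... | no b≰a = ≡.trans (≡.cong pos-part (ℤ.⊖-≰ b≰a))
                   (≡.trans (pos-part-neg (b ℕ.∸ a)) (≡.sym (ℕ.m≤n⇒m∸n≡0 (ℕ.<⇒≤ (ℕ.≰⇒> b≰a)))))
    where
    pos-part-neg : ∀ k → pos-part (- + k) ≡ 0
    pos-part-neg zero = ≡.refl
    pos-part-neg (suc k) = ≡.refl

  opaque
    unfolding _≃_ _⊕_ _⊗_

    ∣ᵖ-of-≃ : ∀ {X dx m j E a} → m ℕ.+ dx ≡ j ℕ.+ E → X /p^ dx ≃ ratio m j ⊗ ι p a → E ∣ᵖ X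
    ∣ᵖ-of-≃ {X} {dx} {m} {j} {E} {a} m+dx≡j+E X≃ = ∣ᵖ-of {E} {k} {X} (*-cancelˡ-∣ (p^ j) {{p^-nonZero j}} p^j·p^E∣p^j·X) (ℕ.m≤n+m E j)
      where
      k : ℕ
      k = j ℕ.+ E
      p^k≡ : p^ k ≡ p^ dx * p^ m
      p^k≡ = ≡.trans (≡.cong p^ (≡.trans (≡.sym m+dx≡j+E) (ℕ.+-comm m dx))) (p^-+ dx m)
      p^k∣p^dx·p^m·a : p^ k ∣ p^ dx * (p^ m * seq a k)
      p^k∣p^dx·p^m·a = ≡.subst (p^ k ∣_) (ℤ.*-assoc (p^ dx) (p^ m) (seq a k)) (∣m⇒∣m*n (seq a k) (∣-reflexive p^k≡))
      p^k∣p^j·X : p^ k ∣ p^ (j ℕ.+ 0) * seq X k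
      p^k∣p^j·X = ≡.subst (p^ k ∣_) (sub-add _ _) (∣m∣n⇒∣m+n (X≃ k) p^k∣p^dx·p^m·a)
        where
        sub-add : ∀ x y → (x - y) + y ≡ x
        sub-add = solve-∀
      p^j·p^E∣p^j·X : p^ j * p^ E ∣ p^ j * seq X k
      p^j·p^E∣p^j·X = ≡.subst₂ _∣_ (p^-+ j E) (≡.cong (λ i → p^ i * seq X k) (ℕ.+-identityʳ j)) p^k∣p^j·X

    ≃-of-∣ᵖ : ∀ {X dx m j E} → m ℕ.+ dx ≡ j ℕ.+ E → E ∣ᵖ X → ∃ λ a → X /p^ dx ≃ ratio m j ⊗ ι p a
    ≃-of-∣ᵖ {X} {dx} {m} {j} {E} m+dx≡j+E E∣X = mkℤp q coherent , X≃
      where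
      q : ℕ → ℤ
      q k = _∣_.quotient (∣ᵖ-shift {E} {X} E∣X k)
      X≡ : ∀ k → seq X (k ℕ.+ E) ≡ q k * p^ E
      X≡ k = _∣_.equality (∣ᵖ-shift {E} {X} E∣X k)
      coherent : ∀ k → p^ k ∣ q (suc k) - q k
      coherent k = *-cancelˡ-∣ (p^ E) {{p^-nonZero E}}
        (≡.subst₂ _∣_ (≡.trans (≡.cong p^ (ℕ.+-comm k E)) (p^-+ E k))
                      (≡.trans (≡.cong₂ _-_ (X≡ (suc k)) (X≡ k)) (factor (q (suc k)) (q k) (p^ E)))
                      (coh X (k ℕ.+ E)))
        where
        factor : ∀ a b c → a * c - b * c ≡ c * (a - b)
        factor = solve-∀
      p^dx·p^m≡p^j·p^E : p^ dx * p^ m ≡ p^ j * p^ E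
      p^dx·p^m≡p^j·p^E = ≡.trans (≡.sym (p^-+ dx m)) (≡.trans (≡.cong p^ (≡.trans (ℕ.+-comm dx m) m+dx≡j+E)) (p^-+ j E))
      X≃ : X /p^ dx ≃ ratio m j ⊗ ι p (mkℤp q coherent)
      X≃ k = ≡.subst (p^ k ∣_) (≡.sym (expand k)) (∣n⇒∣m*n (p^ j) (mod-sym {x = seq X (k ℕ.+ E)} (coherent-≤ X (ℕ.m≤m+n k E))))
        where
        expand : ∀ k → p^ (j ℕ.+ 0) * seq X k - p^ dx * (p^ m * q k) ≡ p^ j * (seq X k - seq X (k ℕ.+ E))
        expand k = ≡.trans (≡.cong₂ (λ u v → p^ u * seq X k - v) (ℕ.+-identityʳ j)
                     (≡.trans (≡.sym (ℤ.*-assoc (p^ dx) (p^ m) (q k))) (≡.cong (_* q k) p^dx·p^m≡p^j·p^E)))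
                     (≡.trans (regroup (p^ j) (p^ E) (seq X k) (q k)) (≡.cong (λ u → p^ j * (seq X k - u)) (≡.sym (X≡ k))))
          where
          regroup : ∀ A B x q → A * x - (A * B) * q ≡ A * (x - q * B)
          regroup = solve-∀

    ≃-scaled : ∀ {X dx m j E} → j ≡ (m ℕ.+ dx) ℕ.+ E → X /p^ dx ≃ ratio m j ⊗ ι p (const (p^ E) *ₚ X)
    ≃-scaled {X} {dx} {m} {j} {E} j≡ = ≃-of-≡ {X /p^ dx} {ratio m j ⊗ ι p (const (p^ E) *ₚ X)} λ k →
      ≡.trans (≡.cong (_* seq X k) (≡.trans (≡.cong p^ (≡.trans (ℕ.+-identityʳ j) j≡)) (p^-+₃′ m dx E)))
              (regroup (p^ m) (p^ dx) (p^ E) (seq X k))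
      where
      regroup : ∀ A B C x → ((A * B) * C) * x ≡ B * (A * (C * x))
      regroup = solve-∀

  -- x ∈ π^t ℤ_p exactly when num x ∈ p^(t + den x) ℤ_p (vacuous when t + den x < 0).
  ∈π^⇒∣ᵖ : ∀ x t → x ∈π^ t → pos-part (t + + den x) ∣ᵖ num x
  ∈π^⇒∣ᵖ (X /p^ dx) (+ m) (a , X≃) = ∣ᵖ-of-≃ {X} {dx} {m} {0} {m ℕ.+ dx} {a} ≡.refl X≃
  ∈π^⇒∣ᵖ (X /p^ dx) -[1+ j ] (a , X≃) with suc j ℕ.≤? dx
  ... | yes j<dx = ≡.subst (_∣ᵖ X) (≡.sym (pos-part-⊖ dx (suc j)))
                     (∣ᵖ-of-≃ {X} {dx} {0} {suc j} {dx ℕ.∸ suc j} {a} (≡.sym (ℕ.m+[n∸m]≡n j<dx)) X≃)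
  ... | no j≮dx =
    ≡.subst (_∣ᵖ X) (≡.sym (≡.trans (pos-part-⊖ dx (suc j)) (ℕ.m≤n⇒m∸n≡0 (ℕ.<⇒≤ (ℕ.≰⇒> j≮dx))))) (∣ᵖ-zero X)

  ∣ᵖ⇒∈π^ : ∀ x t → pos-part (t + + den x) ∣ᵖ num x → x ∈π^ t
  ∣ᵖ⇒∈π^ (X /p^ dx) (+ m) ∣X = ≃-of-∣ᵖ {X} {dx} {m} {0} {m ℕ.+ dx} ≡.refl ∣X
  ∣ᵖ⇒∈π^ (X /p^ dx) -[1+ j ] ∣X with suc j ℕ.≤? dx
  ... | yes j<dx =
    ≃-of-∣ᵖ {X} {dx} {0} {suc j} {dx ℕ.∸ suc j} (≡.sym (ℕ.m+[n∸m]≡n j<dx)) (≡.subst (_∣ᵖ X) (pos-part-⊖ dx (suc j)) ∣X)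
  ... | no j≮dx =
    const (p^ (suc j ℕ.∸ dx)) *ₚ X , ≃-scaled {X} {dx} {0} {suc j} (≡.sym (ℕ.m+[n∸m]≡n (ℕ.<⇒≤ (ℕ.≰⇒> j≮dx))))

  _∈π^?_ : ∀ x t → Dec (x ∈π^ t)
  x ∈π^? t = map′ (∣ᵖ⇒∈π^ x t) (∈π^⇒∣ᵖ x t) (p^ E ∣? seq (num x) E)
    where
    E = pos-part (t + + den x)

  opaque
    unfolding _≃_ _⊗_

    ∈π^-bounded : ∀ x → ∃ λ t → x ∈π^ t
    ∈π^-bounded (X /p^ zero) = + 0 , X , ≃-of-≡ {X /p^ zero} {pow p (+ 0) ⊗ ι p X} λ k → ≡.cong (+ 1 *_) (≡.sym (ℤ.*-identityˡ (seq X k)))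
    ∈π^-bounded (X /p^ suc j) = -[1+ j ] , X , ≃-of-≡ {X /p^ suc j} {pow p -[1+ j ] ⊗ ι p X} λ k →
      ≡.cong₂ _*_ (≡.cong p^ (ℕ.+-identityʳ (suc j))) (≡.sym (ℤ.*-identityˡ (seq X k)))

  module _ (p-prime : Prime p) where

    open PrimePowers p-prime

    power-cancelᵖ : ∀ μ γ X Y → ¬ suc μ ∣ᵖ X → μ ℕ.+ γ ∣ᵖ X *ₚ Y → γ ∣ᵖ Y
    power-cancelᵖ μ zero X Y _ _ = ∣ᵖ-zero Y
    power-cancelᵖ μ (suc γ) X Y X∉ XY∈ =
      ∣ᵖ-of {suc γ} {K} {Y} (∣ᵤ⇒∣ (power-cancel μ (suc γ) ℤ.∣ seq X K ∣ ℤ.∣ seq Y K ∣ p^μ⁺∤X p^K∣XY)) (ℕ.m≤n+m (suc γ) μ)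
      where
      K = μ ℕ.+ suc γ
      p^μ⁺∤X : ¬ p ℕ.^ suc μ ℕ∣ ℤ.∣ seq X K ∣
      p^μ⁺∤X p^μ⁺∣X = X∉ (∣ᵖ-of {suc μ} {K} {X} (∣ᵤ⇒∣ p^μ⁺∣X) (ℕ.m<m+n μ (ℕ.s≤s ℕ.z≤n)))
      p^K∣XY : p ℕ.^ K ℕ∣ ℤ.∣ seq X K ∣ ℕ.* ℤ.∣ seq Y K ∣
      p^K∣XY = ≡.subst (p ℕ.^ K ℕ∣_) (ℤ.abs-* (seq X K) (seq Y K)) (∣⇒∣ᵤ XY∈)

    private
      power-cancel-exponents : ∀ X Y (C M T : ℤ) → C ≡ T + M → ¬ pos-part (ℤ.suc M) ∣ᵖ X → pos-part C ∣ᵖ X *ₚ Y → pos-part T ∣ᵖ Y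
      power-cancel-exponents X Y C -[1+ j ] T _ X∉ _ =
        ⊥-elim (X∉ (≡.subst (_∣ᵖ X) (≡.sym (≡.trans (pos-part-⊖ 1 (suc j)) (ℕ.0∸n≡0 j))) (∣ᵖ-zero X)))
      power-cancel-exponents X Y C (+ μ) -[1+ _ ] _ _ _ = ∣ᵖ-zero Y
      power-cancel-exponents X Y C (+ μ) (+ γ) C≡ X∉ XY∈ =
        power-cancelᵖ μ γ X Y X∉ (≡.subst (_∣ᵖ X *ₚ Y) (≡.trans (≡.cong pos-part C≡) (ℕ.+-comm γ μ)) XY∈)

    opaque
      unfolding _⊗_

      *-∈π^-cancelˡ : ∀ {x y c m} → x ⊗ y ∈π^ c → ¬ x ∈π^ ℤ.suc m → y ∈π^ (c - m)
      *-∈π^-cancelˡ {X /p^ dx} {Y /p^ dy} {c} {m} xy∈ x∉ = ∣ᵖ⇒∈π^ (Y /p^ dy) (c - m)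
        (power-cancel-exponents X Y (c + + (dx ℕ.+ dy)) (m + + dx) ((c - m) + + dy)
          (≡.trans (≡.cong (_+_ c) (ℤ.pos-+ dx dy)) (regroup c m (+ dx) (+ dy)))
          (λ X∈ → x∉ (∣ᵖ⇒∈π^ (X /p^ dx) (ℤ.suc m) (≡.subst (_∣ᵖ X) (≡.cong pos-part (≡.sym (ℤ.+-assoc (+ 1) m (+ dx)))) X∈)))
          (∈π^⇒∣ᵖ ((X /p^ dx) ⊗ (Y /p^ dy)) c xy∈))
        where
        regroup : ∀ c m a b → c + (a + b) ≡ ((c - m) + b) + (m + a)
        regroup = solve-∀

    1∉π^1 : ¬ 1Q p ∈π^ + 1
    1∉π^1 1∈ = ℕ.<⇒≢ (ℕ.nonTrivial⇒n>1 p {{prime⇒nonTrivial p-prime}})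
                 (≡.sym (≡.trans (≡.sym (ℕ.*-identityʳ p)) (ℕ∣.∣1⇒≡1 (∣⇒∣ᵤ (∈π^⇒∣ᵖ (1Q p) (+ 1) 1∈)))))

    ℚp-valuation : DiscreteValuation ℚp-ring
    ℚp-valuation = record
      { π^_ = pow p
      ; _∈π^_ = _∈π^_
      ; π^-+ = pow-+
      ; π^0 = ≃-refl
      ; ∈-resp-≈ = ∈-resp-≃
      ; ∈-weaken = ∈-weaken
      ; 0∈π^ = 0∈π^
      ; π^∈π^ = π^∈π^
      ; +-∈π^ = +-∈π^
      ; *-∈π^ = *-∈π^
      ; *-∈π^-cancelˡ = *-∈π^-cancelˡ
      ; 1∉π^1 = 1∉π^1
      ; ∈π^-bounded = ∈π^-bounded
      ; _∈π^?_ = _∈π^?_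
      }

Rexp≡shape : ∀ p n i j → Rexp p n i j ≡ shape i j ℤ.* + n
Rexp≡shape p n 0F 0F = ≡.refl
Rexp≡shape p n 0F 1F = ≡.sym (ℤ.*-identityˡ (+ n))
Rexp≡shape p n 0F 2F = ≡.refl
Rexp≡shape p n 0F 3F = ≡.refl
Rexp≡shape p n 1F 0F = ≡.refl
Rexp≡shape p n 1F 1F = ≡.refl
Rexp≡shape p n 1F 2F = ≡.refl
Rexp≡shape p n 1F 3F = ≡.sym (ℤ.-1*i≡-i (+ n))
Rexp≡shape p n 2F 0F = ≡.refl
Rexp≡shape p n 2F 1F = ≡.sym (ℤ.*-identityˡ (+ n))
Rexp≡shape p n 2F 2F = ≡.refl
Rexp≡shape p n 2F 3F = ≡.refl
Rexp≡shape p n 3F 0F = ≡.sym (ℤ.*-identityˡ (+ n))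
Rexp≡shape p n 3F 1F = ≡.sym (ℤ.*-identityˡ (+ n))
Rexp≡shape p n 3F 2F = ≡.sym (ℤ.*-identityˡ (+ n))
Rexp≡shape p n 3F 3F = ≡.refl

module DefsBridge (p : ℕ) (p-prime : Prime p) (n : ℕ) where

  private
    instance
      p≢0 : ℕ.NonZero p
      p≢0 = prime⇒nonZero p-prime

  open PAdicIntegers p
  open Matrix4 ℚp-ring using (_∙_; Σ-expand; Σ-cong-≡) renaming (_≈M_ to _≋_)
  module N = Normaliser (ℚp-valuation p-prime) n (Rexp p n) (Rexp≡shape p n)

  opaque
    unfolding _≃_ _⊕_ _⊗_

    ≈⇒≃ : ∀ {x y} → _≈_ p x y → x ≃ y
    ≈⇒≃ x≈y = x≈y

    ≃⇒≈ : ∀ {x y} → x ≃ y → _≈_ p x y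
    ≃⇒≈ x≃y = x≃y

    +Q≡⊕ : ∀ x y → _+Q_ p x y ≡ x ⊕ y
    +Q≡⊕ x y = ≡.refl

    *Q≡⊗ : ∀ x y → _*Q_ p x y ≡ x ⊗ y
    *Q≡⊗ x y = ≡.refl

  private
    +Q-cong : ∀ x y u v → x ≡ y → u ≡ v → _+Q_ p x u ≡ _+Q_ p y v
    +Q-cong x y u v ≡.refl ≡.refl = ≡.refl

  -- All terms are written out: an equation whose sides differ only deep inside is decided by
  -- unfolding the arithmetic of ℚ_p, which is far too expensive.
  sum-of-products : ∀ a₀ a₁ a₂ a₃ b₀ b₁ b₂ b₃ →
    _+Q_ p (_+Q_ p (_+Q_ p (_*Q_ p a₀ b₀) (_*Q_ p a₁ b₁)) (_*Q_ p a₂ b₂)) (_*Q_ p a₃ b₃) ≡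
    a₀ ⊗ b₀ ⊕ a₁ ⊗ b₁ ⊕ a₂ ⊗ b₂ ⊕ a₃ ⊗ b₃
  sum-of-products a₀ a₁ a₂ a₃ b₀ b₁ b₂ b₃ = ≡.trans
    (+Q-cong (_+Q_ p (_+Q_ p (_*Q_ p a₀ b₀) (_*Q_ p a₁ b₁)) (_*Q_ p a₂ b₂)) (a₀ ⊗ b₀ ⊕ a₁ ⊗ b₁ ⊕ a₂ ⊗ b₂)
             (_*Q_ p a₃ b₃) (a₃ ⊗ b₃)
      (≡.trans
        (+Q-cong (_+Q_ p (_*Q_ p a₀ b₀) (_*Q_ p a₁ b₁)) (a₀ ⊗ b₀ ⊕ a₁ ⊗ b₁) (_*Q_ p a₂ b₂) (a₂ ⊗ b₂)
          (≡.trans (+Q-cong (_*Q_ p a₀ b₀) (a₀ ⊗ b₀) (_*Q_ p a₁ b₁) (a₁ ⊗ b₁) (*Q≡⊗ a₀ b₀) (*Q≡⊗ a₁ b₁))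
                   (+Q≡⊕ (a₀ ⊗ b₀) (a₁ ⊗ b₁)))
          (*Q≡⊗ a₂ b₂))
        (+Q≡⊕ (a₀ ⊗ b₀ ⊕ a₁ ⊗ b₁) (a₂ ⊗ b₂)))
      (*Q≡⊗ a₃ b₃))
    (+Q≡⊕ (a₀ ⊗ b₀ ⊕ a₁ ⊗ b₁ ⊕ a₂ ⊗ b₂) (a₃ ⊗ b₃))

  ·≡∙ : ∀ A B i j → _·_ p A B i j ≡ (A ∙ B) i j
  ·≡∙ A B i j = ≡.trans
    (sum-of-products (A i 0F) (A i 1F) (A i 2F) (A i 3F) (B 0F j) (B 1F j) (B 2F j) (B 3F j))
    (≡.sym (Σ-expand λ k → A i k ⊗ B k j))

  ·-·≡∙-∙ : ∀ A B C i j → _·_ p A (_·_ p B C) i j ≡ (A ∙ (B ∙ C)) i j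
  ·-·≡∙-∙ A B C i j = ≡.trans (·≡∙ A (_·_ p B C) i j) (Σ-cong-≡ λ k → ≡.cong (A i k ⊗_) (·≡∙ B C k j))

  W^≡ : ∀ μ i j → W^ p n μ i j ≡ N.W^ μ i j
  W^≡ false i j = ≡.refl
  W^≡ true 0F 0F = ≡.refl
  W^≡ true 0F 1F = ≡.refl
  W^≡ true 0F 2F = ≡.refl
  W^≡ true 0F 3F = ≡.refl
  W^≡ true 1F 0F = ≡.refl
  W^≡ true 1F 1F = ≡.refl
  W^≡ true 1F 2F = ≡.refl
  W^≡ true 1F 3F = ≡.refl
  W^≡ true 2F 0F = ≡.refl
  W^≡ true 2F 1F = ≡.refl
  W^≡ true 2F 2F = ≡.refl
  W^≡ true 2F 3F = ≡.refl
  W^≡ true 3F 0F = ≡.refl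
  W^≡ true 3F 1F = ≡.refl
  W^≡ true 3F 2F = ≡.refl
  W^≡ true 3F 3F = ≡.refl

  ≈M⇔ : ∀ {A A′ B B′} → (∀ i j → A i j ≡ A′ i j) → (∀ i j → B i j ≡ B′ i j) → _≈M_ p A B ⇔ A′ ≋ B′
  ≈M⇔ {A} {A′} {B} {B′} A≡ B≡ = mk⇔
    (λ A≈B i j → ≡.subst₂ _≃_ (A≡ i j) (B≡ i j) (≈⇒≃ (A≈B i j)))
    (λ A≈B i j → ≃⇒≈ (≡.subst₂ _≃_ (≡.sym (A≡ i j)) (≡.sym (B≡ i j)) (A≈B i j)))

  ∈p^⇒∈π^ : ∀ {x t} → _∈p^_ℤp p x t → x ∈π^ t
  ∈p^⇒∈π^ {x} {t} (a , x≈) = a , ≡.subst (x ≃_) (*Q≡⊗ (pow p t) (ι p a)) (≈⇒≃ x≈)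

  ∈π^⇒∈p^ : ∀ {x t} → x ∈π^ t → _∈p^_ℤp p x t
  ∈π^⇒∈p^ {x} {t} (a , x≃) = a , ≃⇒≈ (≡.subst (x ≃_) (≡.sym (*Q≡⊗ (pow p t) (ι p a))) x≃)

  InR⇔ : ∀ {A A′} → (∀ i j → A i j ≡ A′ i j) → InR p n A ⇔ N.InR A′
  InR⇔ {A} {A′} A≡ = mk⇔
    (λ A∈ i j → ≡.subst (_∈π^ Rexp p n i j) (A≡ i j) (∈p^⇒∈π^ (A∈ i j)))
    (λ A∈ i j → ∈π^⇒∈p^ (≡.subst (_∈π^ Rexp p n i j) (≡.sym (A≡ i j)) (A∈ i j)))

  private
    ≡-refl : ∀ {A : Defs.Mat p} i j → A i j ≡ A i j
    ≡-refl i j = ≡.refl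

  module _ {g h : Defs.Mat p} where

    hxg≡ : ∀ x i j → _·_ p h (_·_ p x g) i j ≡ (h ∙ (x ∙ g)) i j
    hxg≡ x = ·-·≡∙-∙ h x g

    Normalises⇔ : Normalises p n g h ⇔ N.Normalises g h
    Normalises⇔ = mk⇔
      (λ (hRg⊆R , R⊆hRg) → (λ x x∈ → to (InR⇔ (hxg≡ x)) (hRg⊆R x (from (InR⇔ ≡-refl) x∈))) ,
                             (λ y y∈ → preimage⁺ (R⊆hRg y (from (InR⇔ ≡-refl) y∈))))
      (λ (hRg⊆R , R⊆hRg) → (λ x x∈ → from (InR⇔ (hxg≡ x)) (hRg⊆R x (to (InR⇔ ≡-refl) x∈))) ,
                             (λ y y∈ → preimage⁻ (R⊆hRg y (to (InR⇔ ≡-refl) y∈))))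
      where
      open Equivalence
      preimage⁺ : ∀ {y} → (∃ λ x → InR p n x × _≈M_ p y (_·_ p h (_·_ p x g))) → ∃ λ x → N.InR x × (y ≋ h ∙ (x ∙ g))
      preimage⁺ (x , x∈ , y≈) = x , to (InR⇔ ≡-refl) x∈ , to (≈M⇔ ≡-refl (hxg≡ x)) y≈
      preimage⁻ : ∀ {y} → (∃ λ x → N.InR x × (y ≋ h ∙ (x ∙ g))) → ∃ λ x → InR p n x × _≈M_ p y (_·_ p h (_·_ p x g))
      preimage⁻ (x , x∈ , y≈) = x , from (InR⇔ ≡-refl) x∈ , from (≈M⇔ ≡-refl (hxg≡ x)) y≈

  module _ {g : Defs.Mat p} where

    scaled≡ : ∀ k μ r i j → scale p (pow p k) (_·_ p (W^ p n μ) r) i j ≡ (pow p k ⊗ (N.W^ μ ∙ r) i j)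
    scaled≡ k μ r i j = ≡.trans (*Q≡⊗ (pow p k) (_·_ p (W^ p n μ) r i j)) (≡.cong (pow p k ⊗_)
      (≡.trans (·≡∙ (W^ p n μ) r i j) (Σ-cong-≡ λ l → ≡.cong (_⊗ r l j) (W^≡ μ i l))))

    InUnion⇔ : InUnion p n g ⇔ N.InUnion g
    InUnion⇔ = mk⇔
      (λ (k , μ , r , (r∈ , r′ , r′∈ , rr′≈I , r′r≈I) , g≈) →
        k , μ , r , (to (InR⇔ ≡-refl) r∈ , r′ , to (InR⇔ ≡-refl) r′∈ ,
                     to (≈M⇔ (·≡∙ r r′) ≡-refl) rr′≈I , to (≈M⇔ (·≡∙ r′ r) ≡-refl) r′r≈I) ,
        to (≈M⇔ ≡-refl (scaled≡ k μ r)) g≈)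
      (λ (k , μ , r , (r∈ , r′ , r′∈ , rr′≈I , r′r≈I) , g≈) →
        k , μ , r , (from (InR⇔ ≡-refl) r∈ , r′ , from (InR⇔ ≡-refl) r′∈ ,
                     from (≈M⇔ (·≡∙ r r′) ≡-refl) rr′≈I , from (≈M⇔ (·≡∙ r′ r) ≡-refl) r′r≈I) ,
        from (≈M⇔ ≡-refl (scaled≡ k μ r)) g≈)
      where open Equivalence

  normaliser-ℚp : ∀ (g h : Defs.Mat p) → _≈M_ p (_·_ p g h) (I p) → _≈M_ p (_·_ p h g) (I p) → (Normalises p n g h ⇔ InUnion p n g)
  normaliser-ℚp g h gh≈I hg≈I = mk⇔
    (λ normalises → from (InUnion⇔ {g}) (to generic (to (Normalises⇔ {g} {h}) normalises)))
    (λ g∈ → from (Normalises⇔ {g} {h}) (from generic (to (InUnion⇔ {g}) g∈)))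
    where
    open Equivalence
    generic : N.Normalises g h ⇔ N.InUnion g
    generic = N.normaliser (to (≈M⇔ (·≡∙ g h) ≡-refl) gh≈I) (to (≈M⇔ (·≡∙ h g) ≡-refl) hg≈I)

mainTheorem20 : (p : ℕ) → Prime p → (n : ℕ) → (g h : Mat p) →
    _≈M_ p (_·_ p g h) (I p) → _≈M_ p (_·_ p h g) (I p) →
    (Normalises p n g h ⇔ InUnion p n g)
mainTheorem20 p p-prime n = DefsBridge.normaliser-ℚp p p-prime n
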